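{- Let $k\ge0$ and $n,p\ge0$ be integers. The number of words $\pi\in[2k+1]^n$ with $\overleftarrow{\mathrm{des}}_O(\pi)=p$, which also equals the number of words $\pi\in[2k+1]^n$ with $\overleftarrow{\mathrm{ris}}_O(\pi)=p$, is $$\sum_{m=0}^n\sum_{j=0}^m\sum_{i=0}^{kj+j}(-1)^{n+p+j}2^{m-n+i}\binom{m}{j}\binom{m-j}{n-i}\binom{jk+j}{i}\binom{n-m}{p}.$$
   Context: $[N]=\{1,\ldots,N\}$, $[N]^n$ is the set of words of length $n$ over $[N]$. $O=\{1,3,5,\ldots\}$. For a word $\pi=\pi_1\cdots\pi_n$ and $X\subseteq\mathbb{N}$, $\overleftarrow{\mathrm{des}}_X(\pi)=|\{i:\pi_i>\pi_{i+1},\ \pi_i\in X\}|$ and $\overleftarrow{\mathrm{ris}}_X(\pi)=|\{i:\pi_i<\pi_{i+1},\ \pi_i\in X\}|$. Convention: $\binom{a}{b}=0$ if $b<0$ or $b>a$ (for $a\ge0$); terms with $2^{m-n+i}$ having negative exponent vanish since then $\binom{m-j}{n-i}=0$. -}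

module Defs where

open import Data.Nat using (ℕ; zero; suc; _+_; _*_; _∸_; _^_; _<ᵇ_; _%_; _≡ᵇ_)
open import Data.Nat.Combinatorics using (_C_)
open import Data.Bool using (Bool; true; false; if_then_else_; _∧_)
open import Data.Fin using (Fin; toℕ)
open import Data.Fin.Properties using (all?)
open import Data.Vec using (Vec; []; _∷_; toList)
open import Data.List as List using (List; []; _∷_; length; filter; concatMap; map)
open import Data.Integer as ℤ using (ℤ; +_; -[1+_])
open import Relation.Binary.PropositionalEquality using (_≡_)
import Data.Nat as ℕ

-- The set [N] = {1,...,N} is represented by Fin N, where x : Fin N stands
-- for the letter toℕ x + 1.  A word of [N]^n is a Vec (Fin N) n.
letter : {N : ℕ} → Fin N → ℕ
letter x = suc (toℕ x)

allWords : (N n : ℕ) → List (Vec (Fin N) n)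
allWords N zero    = [] ∷ []
allWords N (suc n) = concatMap (λ x → map (x ∷_) (allWords N n)) (List.allFin N)

isOdd : ℕ → Bool
isOdd a = a % 2 ≡ᵇ 1

desL : (ℕ → Bool) → List ℕ → ℕ
desL X (a ∷ b ∷ r) = (if X a ∧ (b <ᵇ a) then 1 else 0) + desL X (b ∷ r)
desL X _           = 0

risL : (ℕ → Bool) → List ℕ → ℕ
risL X (a ∷ b ∷ r) = (if X a ∧ (a <ᵇ b) then 1 else 0) + risL X (b ∷ r)
risL X _           = 0

desO : {N n : ℕ} → Vec (Fin N) n → ℕ
desO w = desL isOdd (map letter (toList w))

risO : {N n : ℕ} → Vec (Fin N) n → ℕ
risO w = risL isOdd (map letter (toList w))

countWords : (N n : ℕ) → ((Vec (Fin N) n) → ℕ) → ℕ → ℕ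
countWords N n st p = length (filter (λ w → st w ℕ.≟ p) (allWords N n))

sumTo : ℕ → (ℕ → ℤ) → ℤ
sumTo zero    f = f 0
sumTo (suc n) f = sumTo n f ℤ.+ f (suc n)

binomℤ : ℕ → ℤ → ℕ
binomℤ a (+ b)    = a C b
binomℤ a -[1+ _ ] = 0

sign : ℕ → ℤ
sign e = if e % 2 ≡ᵇ 0 then + 1 else ℤ.- (+ 1)

-- the summand (-1)^{n+p+j} 2^{m-n+i} C(m,j) C(m-j,n-i) C(jk+j,i) C(n-m,p);
-- the exponent m-n+i is taken as (m+i) ∸ n: when m+i<n, C(m-j,n-i)=0 anyway.
summand : (k n p m j i : ℕ) → ℤ
summand k n p m j i =
  sign (n + p + j) ℤ.*
  (+ (2 ^ ((m + i) ∸ n) * (m C j) * binomℤ (m ∸ j) (+ n ℤ.- + i)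
      * ((j * k + j) C i) * ((n ∸ m) C p)))

formula : (k n p : ℕ) → ℤ
formula k n p =
  sumTo n (λ m → sumTo m (λ j → sumTo (k * j + j) (λ i → summand k n p m j i)))

-- Count by binomial moments: with M(n, q) = Σ_w C(st w, q), the number of words with
-- st w = p is Σ_q (-1)^(q+p) C(q, p) M(n, q). M(n, q) counts words with q of their
-- st-pairs marked; such a word begins with a maximal run of ℓ marked pairs, a chain of
-- ℓ + 1 letters, so M(n+1, q) = Σ_ℓ h_ℓ M(n-ℓ, q-ℓ) with h_ℓ the number of chains, and
-- therefore M(n, q) = [x^q] H(x)^(n-q) for H = Σ h_ℓ x^ℓ. For O-descents and O-rises on
-- [2k+1], chains are counted by pairing each odd letter with the even letter above it
-- (rises reduce to descents under x ↦ 2k+2-x), giving x H(x) = 2(1+x)^(k+1) - (2+x).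
-- Expanding (x H)^m by the binomial theorem yields the triple sum.

module Submission where

open import Data.Bool using (Bool; true; false; if_then_else_; _∧_)
open import Data.Fin as Fin using (Fin; toℕ)
open import Data.Integer as ℤ using (ℤ; +_; _+_; _*_; -_; _-_; _^_)
open import Data.Integer.Properties
open import Algebra.Properties.CommutativeSemigroup +-commutativeSemigroup using () renaming (interchange to +-interchange)
open import Data.Integer.Tactic.RingSolver using (solve-∀)
open import Data.List as List using (List; []; _∷_; _++_; map; concatMap; filter; length; tabulate)
open import Data.Nat as ℕ using (ℕ; zero; suc; _∸_; _≤_; _<_; z≤n; s≤s; _<ᵇ_)
import Data.Nat.Properties as ℕₚ
import Data.Nat.Tactic.RingSolver as ℕ-Solver
open import Data.Nat.Combinatorics using (_C_; k>n⇒nCk≡0; nCk+nC[k+1]≡[n+1]C[k+1])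
open import Data.Nat.Induction using (<-rec)
open import Data.Product using (_×_; _,_)
open import Data.Sum using (inj₁; inj₂)
open import Data.Vec using (Vec; []; _∷_)
open import Function using (_∘_)
open import Relation.Nullary using (does)
open import Relation.Binary.PropositionalEquality
open ≡-Reasoning
open import Defs

-- Finite sums

Σ< : ℕ → (ℕ → ℤ) → ℤ
Σ< zero    f = + 0
Σ< (suc n) f = f 0 + Σ< n (f ∘ suc)

Σ-cong : ∀ n {f g : ℕ → ℤ} → (∀ i → i < n → f i ≡ g i) → Σ< n f ≡ Σ< n g
Σ-cong zero    eq = refl
Σ-cong (suc n) eq = cong₂ _+_ (eq 0 (s≤s z≤n)) (Σ-cong n (λ i i<n → eq (suc i) (s≤s i<n)))

Σ-cong-≗ : ∀ n {f g : ℕ → ℤ} → f ≗ g → Σ< n f ≡ Σ< n g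
Σ-cong-≗ n eq = Σ-cong n (λ i _ → eq i)

Σ-zero : ∀ n {f : ℕ → ℤ} → (∀ i → i < n → f i ≡ + 0) → Σ< n f ≡ + 0
Σ-zero zero    _  = refl
Σ-zero (suc n) eq = cong₂ _+_ (eq 0 (s≤s z≤n)) (Σ-zero n (λ i i<n → eq (suc i) (s≤s i<n)))

Σ-init-last : ∀ n (f : ℕ → ℤ) → Σ< (suc n) f ≡ Σ< n f + f n
Σ-init-last zero    f = +-comm (f 0) (+ 0)
Σ-init-last (suc n) f = begin
  f 0 + Σ< (suc n) (f ∘ suc)        ≡⟨ cong (_+_ (f 0)) (Σ-init-last n (f ∘ suc)) ⟩
  f 0 + (Σ< n (f ∘ suc) + f (suc n)) ≡⟨ +-assoc (f 0) _ _ ⟨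
  Σ< (suc n) f + f (suc n)           ∎

Σ-distrib-+ : ∀ n (f g : ℕ → ℤ) → Σ< n (λ i → f i + g i) ≡ Σ< n f + Σ< n g
Σ-distrib-+ zero    f g = refl
Σ-distrib-+ (suc n) f g = begin
  (f 0 + g 0) + Σ< n (λ i → f (suc i) + g (suc i))
    ≡⟨ cong (_+_ (f 0 + g 0)) (Σ-distrib-+ n (f ∘ suc) (g ∘ suc)) ⟩
  (f 0 + g 0) + (Σ< n (f ∘ suc) + Σ< n (g ∘ suc))
    ≡⟨ +-interchange (f 0) (g 0) _ _ ⟩
  Σ< (suc n) f + Σ< (suc n) g ∎

*-distribˡ-Σ : ∀ n c (f : ℕ → ℤ) → c * Σ< n f ≡ Σ< n (λ i → c * f i)
*-distribˡ-Σ zero    c f = *-zeroʳ c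
*-distribˡ-Σ (suc n) c f = begin
  c * (f 0 + Σ< n (f ∘ suc))       ≡⟨ *-distribˡ-+ c (f 0) _ ⟩
  c * f 0 + c * Σ< n (f ∘ suc)     ≡⟨ cong (_+_ (c * f 0)) (*-distribˡ-Σ n c (f ∘ suc)) ⟩
  Σ< (suc n) (λ i → c * f i)       ∎

*-distribʳ-Σ : ∀ n c (f : ℕ → ℤ) → Σ< n f * c ≡ Σ< n (λ i → f i * c)
*-distribʳ-Σ n c f = begin
  Σ< n f * c                 ≡⟨ *-comm (Σ< n f) c ⟩
  c * Σ< n f                 ≡⟨ *-distribˡ-Σ n c f ⟩
  Σ< n (λ i → c * f i)       ≡⟨ Σ-cong-≗ n (λ i → *-comm c (f i)) ⟩
  Σ< n (λ i → f i * c)       ∎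

neg-distrib-Σ : ∀ n (f : ℕ → ℤ) → - Σ< n f ≡ Σ< n (λ i → - f i)
neg-distrib-Σ zero    f = refl
neg-distrib-Σ (suc n) f =
  trans (neg-distrib-+ (f 0) _) (cong (_+_ (- f 0)) (neg-distrib-Σ n (f ∘ suc)))

Σ-split : ∀ a r (f : ℕ → ℤ) → Σ< (a ℕ.+ r) f ≡ Σ< a f + Σ< r (λ i → f (a ℕ.+ i))
Σ-split zero    r f = sym (+-identityˡ _)
Σ-split (suc a) r f = begin
  f 0 + Σ< (a ℕ.+ r) (f ∘ suc)                               ≡⟨ cong (_+_ (f 0)) (Σ-split a r (f ∘ suc)) ⟩
  f 0 + (Σ< a (f ∘ suc) + Σ< r (λ i → f (suc a ℕ.+ i)))      ≡⟨ +-assoc (f 0) _ _ ⟨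
  Σ< (suc a) f + Σ< r (λ i → f (suc a ℕ.+ i))                ∎

Σ-extend : ∀ {n m} (f : ℕ → ℤ) → n ≤ m → (∀ i → n ≤ i → f i ≡ + 0) → Σ< m f ≡ Σ< n f
Σ-extend {n} {m} f n≤m tail = begin
  Σ< m f                                          ≡⟨ cong (λ l → Σ< l f) (ℕₚ.m+[n∸m]≡n n≤m) ⟨
  Σ< (n ℕ.+ (m ∸ n)) f                            ≡⟨ Σ-split n (m ∸ n) f ⟩
  Σ< n f + Σ< (m ∸ n) (λ i → f (n ℕ.+ i))         ≡⟨ cong (_+_ (Σ< n f)) (Σ-zero (m ∸ n) (λ i _ → tail (n ℕ.+ i) (ℕₚ.m≤m+n n i))) ⟩
  Σ< n f + + 0                                    ≡⟨ +-identityʳ _ ⟩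
  Σ< n f                                          ∎

Σ-cutoff : ∀ n m (f : ℕ → ℤ) →
           (∀ i → n ≤ i → f i ≡ + 0) → (∀ i → m ≤ i → f i ≡ + 0) → Σ< n f ≡ Σ< m f
Σ-cutoff n m f tailₙ tailₘ with ℕₚ.≤-total n m
... | inj₁ n≤m = sym (Σ-extend f n≤m tailₙ)
... | inj₂ m≤n = Σ-extend f m≤n tailₘ

Σ-comm : ∀ n m (f : ℕ → ℕ → ℤ) → Σ< n (λ i → Σ< m (f i)) ≡ Σ< m (λ j → Σ< n (λ i → f i j))
Σ-comm zero    m f = sym (Σ-zero m (λ _ _ → refl))
Σ-comm (suc n) m f = begin
  Σ< m (f 0) + Σ< n (λ i → Σ< m (f (suc i)))        ≡⟨ cong (_+_ (Σ< m (f 0))) (Σ-comm n m (f ∘ suc)) ⟩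
  Σ< m (f 0) + Σ< m (λ j → Σ< n (λ i → f (suc i) j)) ≡⟨ Σ-distrib-+ m (f 0) _ ⟨
  Σ< m (λ j → Σ< (suc n) (λ i → f i j))              ∎

Σ-comm-factorʳ : ∀ n m (v : ℕ → ℕ → ℤ) (w : ℕ → ℤ) →
                 Σ< n (λ b → Σ< m (λ ℓ → v ℓ b * w ℓ)) ≡ Σ< m (λ ℓ → Σ< n (v ℓ) * w ℓ)
Σ-comm-factorʳ n m v w = trans (Σ-comm n m (λ b ℓ → v ℓ b * w ℓ)) (Σ-cong-≗ m (λ ℓ → sym (*-distribʳ-Σ n (w ℓ) (v ℓ))))

Σ-reverse : ∀ n (f : ℕ → ℤ) → Σ< n (λ i → f (n ∸ suc i)) ≡ Σ< n f
Σ-reverse zero    f = refl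
Σ-reverse (suc n) f = begin
  f n + Σ< n (λ i → f (n ∸ suc i))  ≡⟨ cong (_+_ (f n)) (Σ-reverse n f) ⟩
  f n + Σ< n f                      ≡⟨ +-comm (f n) _ ⟩
  Σ< n f + f n                      ≡⟨ Σ-init-last n f ⟨
  Σ< (suc n) f                      ∎

sumTo≡Σ< : ∀ n f → sumTo n f ≡ Σ< (suc n) f
sumTo≡Σ< zero    f = sym (+-identityʳ (f 0))
sumTo≡Σ< (suc n) f = begin
  sumTo n f + f (suc n)      ≡⟨ cong (_+ f (suc n)) (sumTo≡Σ< n f) ⟩
  Σ< (suc n) f + f (suc n)   ≡⟨ Σ-init-last (suc n) f ⟨
  Σ< (suc (suc n)) f         ∎

-- sign (2 + e) and sign e are definitionally equal: the builtin behind _%_ unfolds twice.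
sign-suc : ∀ e → sign (suc e) ≡ - sign e
sign-suc zero          = refl
sign-suc (suc zero)    = refl
sign-suc (suc (suc e)) = sign-suc e

sign-+ : ∀ a b → sign (a ℕ.+ b) ≡ sign a * sign b
sign-+ zero    b = sym (*-identityˡ (sign b))
sign-+ (suc a) b = begin
  sign (suc (a ℕ.+ b))   ≡⟨ sign-suc (a ℕ.+ b) ⟩
  - sign (a ℕ.+ b)       ≡⟨ cong -_ (sign-+ a b) ⟩
  - (sign a * sign b)    ≡⟨ neg-distribˡ-* (sign a) (sign b) ⟩
  - sign a * sign b      ≡⟨ cong (_* sign b) (sign-suc a) ⟨
  sign (suc a) * sign b  ∎

-1^≡sign : ∀ e → (- + 1) ^ e ≡ sign e
-1^≡sign zero    = refl
-1^≡sign (suc e) = begin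
  - + 1 * (- + 1) ^ e    ≡⟨ cong (- + 1 *_) (-1^≡sign e) ⟩
  - + 1 * sign e         ≡⟨ -1*i≡-i (sign e) ⟩
  - sign e               ≡⟨ sign-suc e ⟨
  sign (suc e)           ∎

sign-+-double : ∀ a b → sign (a ℕ.+ (b ℕ.+ b)) ≡ sign a
sign-+-double a zero    = cong sign (ℕₚ.+-identityʳ a)
sign-+-double a (suc b) = trans (cong sign (two-more a b)) (sign-+-double a b)
  where
  two-more : ∀ a b → a ℕ.+ (suc b ℕ.+ suc b) ≡ suc (suc (a ℕ.+ (b ℕ.+ b)))
  two-more = ℕ-Solver.solve-∀

-- Binomial coefficients

binom : ℕ → ℕ → ℤ
binom a i = + (a C i)

binom-suc-suc : ∀ a i → binom (suc a) (suc i) ≡ binom a (suc i) + binom a i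
binom-suc-suc a i = begin
  + (suc a C suc i)                ≡⟨ cong +_ (nCk+nC[k+1]≡[n+1]C[k+1] a i) ⟨
  + (a C i ℕ.+ a C suc i)          ≡⟨ cong +_ (ℕₚ.+-comm (a C i) _) ⟩
  + (a C suc i ℕ.+ a C i)          ≡⟨ pos-+ (a C suc i) (a C i) ⟩
  binom a (suc i) + binom a i      ∎

binom-vanish : ∀ {a i} → a < i → binom a i ≡ + 0
binom-vanish a<i = cong +_ (k>n⇒nCk≡0 a<i)

Σ-pascal : ∀ m (u : ℕ → ℤ) →
           Σ< (suc (suc m)) (λ j → binom (suc m) j * u j)
           ≡ Σ< (suc m) (λ j → binom m j * u j) + Σ< (suc m) (λ j → binom m j * u (suc j))
Σ-pascal m u = begin
  u₀ + Σ< (suc m) (λ j → binom (suc m) (suc j) * u (suc j))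
    ≡⟨ cong (_+_ u₀) (Σ-cong-≗ (suc m) (λ j → cong (_* u (suc j)) (binom-suc-suc m j))) ⟩
  u₀ + Σ< (suc m) (λ j → (binom m (suc j) + binom m j) * u (suc j))
    ≡⟨ cong (_+_ u₀) (trans (Σ-cong-≗ (suc m) (λ j → *-distribʳ-+ (u (suc j)) (binom m (suc j)) (binom m j)))
                            (Σ-distrib-+ (suc m) (λ j → binom m (suc j) * u (suc j)) (λ j → binom m j * u (suc j)))) ⟩
  u₀ + (Σ< (suc m) (λ j → binom m (suc j) * u (suc j)) + Σ< (suc m) (λ j → binom m j * u (suc j)))
    ≡⟨ cong (λ s → u₀ + (s + Σ< (suc m) (λ j → binom m j * u (suc j)))) top-term-vanishes ⟩
  u₀ + (Σ< m (λ j → binom m (suc j) * u (suc j)) + Σ< (suc m) (λ j → binom m j * u (suc j)))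
    ≡⟨ +-assoc u₀ _ _ ⟨
  Σ< (suc m) (λ j → binom m j * u j) + Σ< (suc m) (λ j → binom m j * u (suc j)) ∎
  where
  u₀ = binom m 0 * u 0
  top-term-vanishes : Σ< (suc m) (λ j → binom m (suc j) * u (suc j)) ≡ Σ< m (λ j → binom m (suc j) * u (suc j))
  top-term-vanishes = Σ-extend _ (ℕₚ.n≤1+n m)
    (λ j m≤j → trans (cong (_* u (suc j)) (binom-vanish (s≤s m≤j))) (*-zeroˡ (u (suc j))))

Σ-hockey-stick : ∀ r j → Σ< r (λ i → binom i j) ≡ binom r (suc j)
Σ-hockey-stick zero    j = refl
Σ-hockey-stick (suc r) j = begin
  Σ< (suc r) (λ i → binom i j)        ≡⟨ Σ-init-last r (λ i → binom i j) ⟩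
  Σ< r (λ i → binom i j) + binom r j  ≡⟨ cong (_+ binom r j) (Σ-hockey-stick r j) ⟩
  binom r (suc j) + binom r j         ≡⟨ binom-suc-suc r j ⟨
  binom (suc r) (suc j)               ∎

binom⁻¹ : ℕ → ℕ → ℤ
binom⁻¹ q p = sign (q ℕ.+ p) * binom q p

binom⁻¹-suc-zero : ∀ q → binom⁻¹ (suc q) 0 ≡ - binom⁻¹ q 0
binom⁻¹-suc-zero q = begin
  sign (suc q ℕ.+ 0) * + 1     ≡⟨ cong (_* + 1) (sign-suc (q ℕ.+ 0)) ⟩
  - sign (q ℕ.+ 0) * + 1       ≡⟨ neg-distribˡ-* (sign (q ℕ.+ 0)) (+ 1) ⟨
  - binom⁻¹ q 0                ∎

binom⁻¹-pascal : ∀ q p → binom⁻¹ q p ≡ binom⁻¹ q (suc p) + binom⁻¹ (suc q) (suc p)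
binom⁻¹-pascal q p = begin
  sign (q ℕ.+ p) * binom q p
    ≡⟨ pascal-signs (sign (q ℕ.+ p)) (binom q (suc p)) (binom q p) ⟩
  - sign (q ℕ.+ p) * binom q (suc p) + sign (q ℕ.+ p) * (binom q (suc p) + binom q p)
    ≡⟨ cong₂ (λ s t → s * binom q (suc p) + sign (q ℕ.+ p) * t) (sign-suc (q ℕ.+ p)) (binom-suc-suc q p) ⟨
  sign (suc (q ℕ.+ p)) * binom q (suc p) + sign (q ℕ.+ p) * binom (suc q) (suc p)
    ≡⟨ cong (λ e → sign e * binom q (suc p) + sign (suc e) * binom (suc q) (suc p)) (ℕₚ.+-suc q p) ⟨
  binom⁻¹ q (suc p) + binom⁻¹ (suc q) (suc p) ∎
  where
  pascal-signs : ∀ s b₁ b₀ → s * b₀ ≡ - s * b₁ + s * (b₁ + b₀)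
  pascal-signs = solve-∀

eqIndicator : ℕ → ℕ → ℤ
eqIndicator d p = if does (d ℕ.≟ p) then + 1 else + 0

binomial-inversion : ∀ d p → Σ< (suc d) (λ q → binom d q * binom⁻¹ q p) ≡ eqIndicator d p
binomial-inversion zero    zero    = refl
binomial-inversion zero    (suc p) = cong (λ s → + 1 * s + + 0) (*-zeroʳ (sign (suc p)))
binomial-inversion (suc d) zero    = begin
  Σ< (suc (suc d)) (λ q → binom (suc d) q * binom⁻¹ q 0)    ≡⟨ Σ-pascal d (λ q → binom⁻¹ q 0) ⟩
  S + Σ< (suc d) (λ q → binom d q * binom⁻¹ (suc q) 0)       ≡⟨ cong (_+_ S) (Σ-cong-≗ (suc d) flip) ⟩
  S + Σ< (suc d) (λ q → - (binom d q * binom⁻¹ q 0))         ≡⟨ cong (_+_ S) (neg-distrib-Σ (suc d) (λ q → binom d q * binom⁻¹ q 0)) ⟨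
  S - S                                                       ≡⟨ +-inverseʳ S ⟩
  + 0                                                         ∎
  where
  S = Σ< (suc d) (λ q → binom d q * binom⁻¹ q 0)
  flip : ∀ q → binom d q * binom⁻¹ (suc q) 0 ≡ - (binom d q * binom⁻¹ q 0)
  flip q = trans (cong (binom d q *_) (binom⁻¹-suc-zero q)) (sym (neg-distribʳ-* (binom d q) (binom⁻¹ q 0)))
binomial-inversion (suc d) (suc p) = begin
  Σ< (suc (suc d)) (λ q → binom (suc d) q * binom⁻¹ q (suc p))
    ≡⟨ Σ-pascal d (λ q → binom⁻¹ q (suc p)) ⟩
  Σ< (suc d) (λ q → binom d q * binom⁻¹ q (suc p)) + Σ< (suc d) (λ q → binom d q * binom⁻¹ (suc q) (suc p))
    ≡⟨ Σ-distrib-+ (suc d) (λ q → binom d q * binom⁻¹ q (suc p)) (λ q → binom d q * binom⁻¹ (suc q) (suc p)) ⟨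
  Σ< (suc d) (λ q → binom d q * binom⁻¹ q (suc p) + binom d q * binom⁻¹ (suc q) (suc p))
    ≡⟨ Σ-cong-≗ (suc d) (λ q → trans (cong (binom d q *_) (binom⁻¹-pascal q p))
                                     (*-distribˡ-+ (binom d q) (binom⁻¹ q (suc p)) (binom⁻¹ (suc q) (suc p)))) ⟨
  Σ< (suc d) (λ q → binom d q * binom⁻¹ q p)
    ≡⟨ binomial-inversion d p ⟩
  eqIndicator d p ∎

-- Power series

Series : Set
Series = ℕ → ℤ

one : Series
one zero    = + 1
one (suc _) = + 0

shift : Series → Series
shift f zero    = + 0
shift f (suc n) = f n

shiftBy : ℕ → Series → Series
shiftBy zero    f = f
shiftBy (suc ℓ) f = shift (shiftBy ℓ f)

infixl 6 _⊕_
infixl 7 _•_ _⊛_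
infixr 8 _⊛^_

_⊕_ : Series → Series → Series
(f ⊕ g) n = f n + g n

_•_ : ℤ → Series → Series
(c • f) n = c * f n

_⊛_ : Series → Series → Series
(f ⊛ g) n = Σ< (suc n) (λ i → f i * g (n ∸ i))

_⊛^_ : Series → ℕ → Series
f ⊛^ zero  = one
f ⊛^ suc m = f ⊛ f ⊛^ m

shift-cong : ∀ {f g} → f ≗ g → shift f ≗ shift g
shift-cong eq zero    = refl
shift-cong eq (suc n) = eq n

shiftBy-cong : ∀ ℓ {f g} → f ≗ g → shiftBy ℓ f ≗ shiftBy ℓ g
shiftBy-cong zero    eq = eq
shiftBy-cong (suc ℓ) eq = shift-cong (shiftBy-cong ℓ eq)

shiftBy-≤ : ∀ ℓ f {q} → ℓ ≤ q → shiftBy ℓ f q ≡ f (q ∸ ℓ)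
shiftBy-≤ zero    f _         = refl
shiftBy-≤ (suc ℓ) f (s≤s ℓ≤q) = shiftBy-≤ ℓ f ℓ≤q

shiftBy-> : ∀ ℓ f {q} → q < ℓ → shiftBy ℓ f q ≡ + 0
shiftBy-> (suc ℓ) f {zero}  _         = refl
shiftBy-> (suc ℓ) f {suc q} (s≤s q<ℓ) = shiftBy-> ℓ f q<ℓ

⊛-cong : ∀ {f f′ g g′} → f ≗ f′ → g ≗ g′ → f ⊛ g ≗ f′ ⊛ g′
⊛-cong eqf eqg n = Σ-cong-≗ (suc n) (λ i → cong₂ _*_ (eqf i) (eqg (n ∸ i)))

⊛^-cong : ∀ {f g} m → f ≗ g → f ⊛^ m ≗ g ⊛^ m
⊛^-cong zero    eq = λ _ → refl
⊛^-cong (suc m) eq = ⊛-cong eq (⊛^-cong m eq)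

⊛-comm : ∀ f g → f ⊛ g ≗ g ⊛ f
⊛-comm f g n = begin
  Σ< (suc n) (λ i → f i * g (n ∸ i))                 ≡⟨ Σ-reverse (suc n) (λ i → f i * g (n ∸ i)) ⟨
  Σ< (suc n) (λ i → f (n ∸ i) * g (n ∸ (n ∸ i)))     ≡⟨ Σ-cong (suc n) (λ i i≤n → reflect i (ℕₚ.≤-pred i≤n)) ⟩
  Σ< (suc n) (λ i → g i * f (n ∸ i))                 ∎
  where
  reflect : ∀ i → i ≤ n → f (n ∸ i) * g (n ∸ (n ∸ i)) ≡ g i * f (n ∸ i)
  reflect i i≤n = trans (cong (λ j → f (n ∸ i) * g j) (ℕₚ.m∸[m∸n]≡n i≤n)) (*-comm (f (n ∸ i)) (g i))

⊛-distribʳ-⊕ : ∀ f g h → (f ⊕ g) ⊛ h ≗ f ⊛ h ⊕ g ⊛ h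
⊛-distribʳ-⊕ f g h n = trans (Σ-cong-≗ (suc n) (λ i → *-distribʳ-+ (h (n ∸ i)) (f i) (g i)))
                              (Σ-distrib-+ (suc n) (λ i → f i * h (n ∸ i)) (λ i → g i * h (n ∸ i)))

•-⊛ : ∀ c f g → (c • f) ⊛ g ≗ c • (f ⊛ g)
•-⊛ c f g n = trans (Σ-cong-≗ (suc n) (λ i → *-assoc c (f i) (g (n ∸ i))))
                    (sym (*-distribˡ-Σ (suc n) c (λ i → f i * g (n ∸ i))))

⊛-• : ∀ c f g → f ⊛ (c • g) ≗ c • (f ⊛ g)
⊛-• c f g n = trans (⊛-comm f (c • g) n) (trans (•-⊛ c g f n) (cong (c *_) (⊛-comm g f n)))

one-⊛ : ∀ g → one ⊛ g ≗ g
one-⊛ g n = trans (cong₂ _+_ (*-identityˡ (g n)) (Σ-zero n (λ _ _ → refl))) (+-identityʳ (g n))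

shift-⊛ : ∀ f g → shift f ⊛ g ≗ shift (f ⊛ g)
shift-⊛ f g zero    = refl
shift-⊛ f g (suc n) = +-identityˡ _

⊛-shift : ∀ f g → f ⊛ shift g ≗ shift (f ⊛ g)
⊛-shift f g n = trans (⊛-comm f (shift g) n) (trans (shift-⊛ g f n) (shift-cong (⊛-comm g f) n))

⊛-shiftBy : ∀ ℓ f g → f ⊛ shiftBy ℓ g ≗ shiftBy ℓ (f ⊛ g)
⊛-shiftBy zero    f g = λ _ → refl
⊛-shiftBy (suc ℓ) f g n = trans (⊛-shift f (shiftBy ℓ g) n) (shift-cong (⊛-shiftBy ℓ f g) n)

⊛-unfoldˡ : ∀ f g → f ⊛ g ≗ f 0 • g ⊕ shift ((f ∘ suc) ⊛ g)
⊛-unfoldˡ f g zero    = refl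
⊛-unfoldˡ f g (suc n) = refl

⊛-assoc : ∀ f g h → (f ⊛ g) ⊛ h ≗ f ⊛ (g ⊛ h)
⊛-assoc f g h n = begin
  ((f ⊛ g) ⊛ h) n                                        ≡⟨ ⊛-cong {g = h} (⊛-unfoldˡ f g) (λ _ → refl) n ⟩
  ((f 0 • g ⊕ shift (f′ ⊛ g)) ⊛ h) n                     ≡⟨ ⊛-distribʳ-⊕ (f 0 • g) (shift (f′ ⊛ g)) h n ⟩
  ((f 0 • g) ⊛ h) n + (shift (f′ ⊛ g) ⊛ h) n             ≡⟨ cong₂ _+_ (•-⊛ (f 0) g h n) (shift-⊛ (f′ ⊛ g) h n) ⟩
  f 0 * (g ⊛ h) n + shift ((f′ ⊛ g) ⊛ h) n               ≡⟨ cong (_+_ (f 0 * (g ⊛ h) n)) (tail n) ⟩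
  f 0 * (g ⊛ h) n + shift (f′ ⊛ (g ⊛ h)) n               ≡⟨ ⊛-unfoldˡ f (g ⊛ h) n ⟨
  (f ⊛ (g ⊛ h)) n                                        ∎
  where
  f′ = f ∘ suc
  tail : ∀ n → shift ((f′ ⊛ g) ⊛ h) n ≡ shift (f′ ⊛ (g ⊛ h)) n
  tail zero    = refl
  tail (suc n) = ⊛-assoc f′ g h n

⊛-Σ : ∀ f J (h : ℕ → Series) n → (f ⊛ (λ t → Σ< J (λ j → h j t))) n ≡ Σ< J (λ j → (f ⊛ h j) n)
⊛-Σ f J h n = begin
  Σ< (suc n) (λ i → f i * Σ< J (λ j → h j (n ∸ i)))   ≡⟨ Σ-cong-≗ (suc n) (λ i → *-distribˡ-Σ J (f i) (λ j → h j (n ∸ i))) ⟩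
  Σ< (suc n) (λ i → Σ< J (λ j → f i * h j (n ∸ i)))   ≡⟨ Σ-comm (suc n) J (λ i j → f i * h j (n ∸ i)) ⟩
  Σ< J (λ j → (f ⊛ h j) n)                            ∎

⊛^-binomial : ∀ f g m n →
              ((f ⊕ g) ⊛^ m) n ≡ Σ< (suc m) (λ j → binom m j * (f ⊛^ j ⊛ g ⊛^ (m ∸ j)) n)
⊛^-binomial f g zero    n = sym (trans (+-identityʳ _) (trans (*-identityˡ _) (one-⊛ one n)))
⊛^-binomial f g (suc m) n = begin
  ((f ⊕ g) ⊛ P) n                                        ≡⟨ ⊛-distribʳ-⊕ f g P n ⟩
  (f ⊛ P) n + (g ⊛ P) n                                  ≡⟨ cong₂ _+_ (expand f) (expand g) ⟩
  Σ< (suc m) (λ j → binom m j * (f ⊛ T j) n) + Σ< (suc m) (λ j → binom m j * (g ⊛ T j) n)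
    ≡⟨ cong₂ _+_ (Σ-cong-≗ (suc m) (λ j → cong (binom m j *_) (f-step j)))
                 (Σ-cong (suc m) (λ j j≤m → cong (binom m j *_) (g-step j (ℕₚ.≤-pred j≤m)))) ⟩
  Σ< (suc m) (λ j → binom m j * u (suc j)) + Σ< (suc m) (λ j → binom m j * u j)
    ≡⟨ +-comm (Σ< (suc m) (λ j → binom m j * u (suc j))) (Σ< (suc m) (λ j → binom m j * u j)) ⟩
  Σ< (suc m) (λ j → binom m j * u j) + Σ< (suc m) (λ j → binom m j * u (suc j))
    ≡⟨ Σ-pascal m u ⟨
  Σ< (suc (suc m)) (λ j → binom (suc m) j * u j) ∎
  where
  P : Series
  P = (f ⊕ g) ⊛^ m
  T : ℕ → Series
  T j = f ⊛^ j ⊛ g ⊛^ (m ∸ j)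
  u : ℕ → ℤ
  u j = (f ⊛^ j ⊛ g ⊛^ (suc m ∸ j)) n
  expand : ∀ h → (h ⊛ P) n ≡ Σ< (suc m) (λ j → binom m j * (h ⊛ T j) n)
  expand h = begin
    (h ⊛ P) n                                             ≡⟨ ⊛-cong {f = h} (λ _ → refl) (⊛^-binomial f g m) n ⟩
    (h ⊛ (λ t → Σ< (suc m) (λ j → (binom m j • T j) t))) n ≡⟨ ⊛-Σ h (suc m) (λ j → binom m j • T j) n ⟩
    Σ< (suc m) (λ j → (h ⊛ (binom m j • T j)) n)            ≡⟨ Σ-cong-≗ (suc m) (λ j → ⊛-• (binom m j) h (T j) n) ⟩
    Σ< (suc m) (λ j → binom m j * (h ⊛ T j) n)            ∎
  f-step : ∀ j → (f ⊛ T j) n ≡ u (suc j)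
  f-step j = sym (⊛-assoc f (f ⊛^ j) (g ⊛^ (m ∸ j)) n)
  g-step : ∀ j → j ≤ m → (g ⊛ T j) n ≡ u j
  g-step j j≤m = begin
    (g ⊛ (F ⊛ G)) n          ≡⟨ ⊛-assoc g F G n ⟨
    ((g ⊛ F) ⊛ G) n          ≡⟨ ⊛-cong {g = G} (⊛-comm g F) (λ _ → refl) n ⟩
    ((F ⊛ g) ⊛ G) n          ≡⟨ ⊛-assoc F g G n ⟩
    (F ⊛ g ⊛^ suc (m ∸ j)) n ≡⟨ cong (λ e → (F ⊛ g ⊛^ e) n) (ℕₚ.+-∸-assoc 1 j≤m) ⟨
    u j                      ∎
    where
    F = f ⊛^ j
    G = g ⊛^ (m ∸ j)

binom-zero : binom 0 ≗ one
binom-zero zero    = refl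
binom-zero (suc i) = refl

binom-suc : ∀ a → binom (suc a) ≗ binom a ⊕ shift (binom a)
binom-suc a zero    = refl
binom-suc a (suc i) = binom-suc-suc a i

binom-vandermonde : ∀ a b → binom (a ℕ.+ b) ≗ binom a ⊛ binom b
binom-vandermonde zero    b n = sym (trans (⊛-cong {g = binom b} binom-zero (λ _ → refl) n) (one-⊛ (binom b) n))
binom-vandermonde (suc a) b n = begin
  binom (suc (a ℕ.+ b)) n                                 ≡⟨ binom-suc (a ℕ.+ b) n ⟩
  binom (a ℕ.+ b) n + shift (binom (a ℕ.+ b)) n           ≡⟨ cong₂ _+_ (binom-vandermonde a b n) (shift-cong (binom-vandermonde a b) n) ⟩
  (A ⊛ B) n + shift (A ⊛ B) n                             ≡⟨ cong (_+_ ((A ⊛ B) n)) (shift-⊛ A B n) ⟨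
  (A ⊛ B) n + (shift A ⊛ B) n                             ≡⟨ ⊛-distribʳ-⊕ A (shift A) B n ⟨
  ((A ⊕ shift A) ⊛ B) n                                   ≡⟨ ⊛-cong {g = B} (binom-suc a) (λ _ → refl) n ⟨
  (binom (suc a) ⊛ B) n                                   ∎
  where
  A = binom a
  B = binom b

binom-⊛^ : ∀ a j → binom a ⊛^ j ≗ binom (j ℕ.* a)
binom-⊛^ a zero    n = sym (binom-zero n)
binom-⊛^ a (suc j) n = trans (⊛-cong {f = binom a} (λ _ → refl) (binom-⊛^ a j) n) (sym (binom-vandermonde a (j ℕ.* a) n))

•-⊛^ : ∀ c f j → (c • f) ⊛^ j ≗ (c ^ j) • (f ⊛^ j)
•-⊛^ c f zero    n = sym (*-identityˡ (one n))
•-⊛^ c f (suc j) n = begin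
  ((c • f) ⊛ (c • f) ⊛^ j) n            ≡⟨ ⊛-cong {f = c • f} (λ _ → refl) (•-⊛^ c f j) n ⟩
  ((c • f) ⊛ ((c ^ j) • f ⊛^ j)) n      ≡⟨ •-⊛ c f ((c ^ j) • f ⊛^ j) n ⟩
  c * (f ⊛ ((c ^ j) • f ⊛^ j)) n        ≡⟨ cong (c *_) (⊛-• (c ^ j) f (f ⊛^ j) n) ⟩
  c * (c ^ j * (f ⊛ f ⊛^ j) n)          ≡⟨ *-assoc c (c ^ j) _ ⟨
  c ^ suc j * (f ⊛^ suc j) n            ∎

shift-⊛^ : ∀ f m → shift f ⊛^ m ≗ shiftBy m (f ⊛^ m)
shift-⊛^ f zero    n = refl
shift-⊛^ f (suc m) n = begin
  (shift f ⊛ shift f ⊛^ m) n               ≡⟨ ⊛-cong {f = shift f} (λ _ → refl) (shift-⊛^ f m) n ⟩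
  (shift f ⊛ shiftBy m (f ⊛^ m)) n         ≡⟨ shift-⊛ f (shiftBy m (f ⊛^ m)) n ⟩
  shift (f ⊛ shiftBy m (f ⊛^ m)) n         ≡⟨ shift-cong (⊛-shiftBy m f (f ⊛^ m)) n ⟩
  shiftBy (suc m) (f ⊛^ suc m) n           ∎

twoPlusX : Series
twoPlusX = + 2 • one ⊕ shift one

twoPlusX-⊛ : ∀ f → twoPlusX ⊛ f ≗ + 2 • f ⊕ shift f
twoPlusX-⊛ f n = begin
  (twoPlusX ⊛ f) n                          ≡⟨ ⊛-distribʳ-⊕ (+ 2 • one) (shift one) f n ⟩
  (+ 2 • one ⊛ f) n + (shift one ⊛ f) n     ≡⟨ cong₂ _+_ (•-⊛ (+ 2) one f n) (shift-⊛ one f n) ⟩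
  + 2 * (one ⊛ f) n + shift (one ⊛ f) n     ≡⟨ cong₂ _+_ (cong (+ 2 *_) (one-⊛ f n)) (shift-cong (one-⊛ f) n) ⟩
  + 2 * f n + shift f n                     ∎

twoPowerBinom : ℕ → ℕ → ℕ
twoPowerBinom b t = 2 ℕ.^ (b ∸ t) ℕ.* (b C t)

twoPowerBinom-suc-zero : ∀ b → twoPowerBinom (suc b) 0 ≡ 2 ℕ.* twoPowerBinom b 0
twoPowerBinom-suc-zero b = ℕₚ.*-assoc 2 (2 ℕ.^ b) 1

twoPowerBinom-suc-suc : ∀ b t → twoPowerBinom (suc b) (suc t) ≡ twoPowerBinom b t ℕ.+ 2 ℕ.* twoPowerBinom b (suc t)
twoPowerBinom-suc-suc b t = begin
  2 ℕ.^ (b ∸ t) ℕ.* (suc b C suc t)                       ≡⟨ cong (2 ℕ.^ (b ∸ t) ℕ.*_) (nCk+nC[k+1]≡[n+1]C[k+1] b t) ⟨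
  2 ℕ.^ (b ∸ t) ℕ.* ((b C t) ℕ.+ (b C suc t))             ≡⟨ ℕₚ.*-distribˡ-+ (2 ℕ.^ (b ∸ t)) (b C t) (b C suc t) ⟩
  twoPowerBinom b t ℕ.+ 2 ℕ.^ (b ∸ t) ℕ.* (b C suc t)     ≡⟨ cong (twoPowerBinom b t ℕ.+_) double ⟩
  twoPowerBinom b t ℕ.+ 2 ℕ.* twoPowerBinom b (suc t)     ∎
  where
  double : 2 ℕ.^ (b ∸ t) ℕ.* (b C suc t) ≡ 2 ℕ.* twoPowerBinom b (suc t)
  double with ℕₚ.<-≤-connex t b
  ... | inj₁ t<b = begin
    2 ℕ.^ (b ∸ t) ℕ.* (b C suc t)              ≡⟨ cong (λ e → 2 ℕ.^ e ℕ.* (b C suc t)) (ℕₚ.+-∸-assoc 1 t<b) ⟩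
    2 ℕ.* 2 ℕ.^ (b ∸ suc t) ℕ.* (b C suc t)    ≡⟨ ℕₚ.*-assoc 2 (2 ℕ.^ (b ∸ suc t)) (b C suc t) ⟩
    2 ℕ.* twoPowerBinom b (suc t)              ∎
  ... | inj₂ b≤t = begin
    2 ℕ.^ (b ∸ t) ℕ.* (b C suc t)              ≡⟨ cong (2 ℕ.^ (b ∸ t) ℕ.*_) vanish ⟩
    2 ℕ.^ (b ∸ t) ℕ.* 0                        ≡⟨ ℕₚ.*-zeroʳ (2 ℕ.^ (b ∸ t)) ⟩
    0                                          ≡⟨ cong (2 ℕ.*_) (ℕₚ.*-zeroʳ (2 ℕ.^ (b ∸ suc t))) ⟨
    2 ℕ.* (2 ℕ.^ (b ∸ suc t) ℕ.* 0)            ≡⟨ cong (λ c → 2 ℕ.* (2 ℕ.^ (b ∸ suc t) ℕ.* c)) vanish ⟨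
    2 ℕ.* twoPowerBinom b (suc t)              ∎
    where
    vanish : b C suc t ≡ 0
    vanish = k>n⇒nCk≡0 (s≤s b≤t)

twoPlusX-⊛^ : ∀ b t → (twoPlusX ⊛^ b) t ≡ + twoPowerBinom b t
twoPlusX-⊛^ zero    zero    = refl
twoPlusX-⊛^ zero    (suc t) = refl
twoPlusX-⊛^ (suc b) t = begin
  (twoPlusX ⊛ twoPlusX ⊛^ b) t                         ≡⟨ twoPlusX-⊛ (twoPlusX ⊛^ b) t ⟩
  + 2 * (twoPlusX ⊛^ b) t + shift (twoPlusX ⊛^ b) t    ≡⟨ cong₂ (λ x y → + 2 * x + y) (twoPlusX-⊛^ b t) (shift-cong (twoPlusX-⊛^ b) t) ⟩
  + 2 * + twoPowerBinom b t + shift (+_ ∘ twoPowerBinom b) t ≡⟨ pascal t ⟩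
  + twoPowerBinom (suc b) t                            ∎
  where
  pascal : ∀ t → + 2 * + twoPowerBinom b t + shift (+_ ∘ twoPowerBinom b) t ≡ + twoPowerBinom (suc b) t
  pascal zero    = begin
    + 2 * + twoPowerBinom b 0 + + 0    ≡⟨ +-identityʳ (+ 2 * + twoPowerBinom b 0) ⟩
    + 2 * + twoPowerBinom b 0          ≡⟨ pos-* 2 (twoPowerBinom b 0) ⟨
    + (2 ℕ.* twoPowerBinom b 0)        ≡⟨ cong +_ (twoPowerBinom-suc-zero b) ⟨
    + twoPowerBinom (suc b) 0          ∎
  pascal (suc t) = begin
    + 2 * + twoPowerBinom b (suc t) + + twoPowerBinom b t  ≡⟨ cong (_+ + twoPowerBinom b t) (pos-* 2 (twoPowerBinom b (suc t))) ⟨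
    + (2 ℕ.* twoPowerBinom b (suc t)) + + twoPowerBinom b t ≡⟨ pos-+ (2 ℕ.* twoPowerBinom b (suc t)) (twoPowerBinom b t) ⟨
    + (2 ℕ.* twoPowerBinom b (suc t) ℕ.+ twoPowerBinom b t) ≡⟨ cong +_ (ℕₚ.+-comm _ (twoPowerBinom b t)) ⟩
    + (twoPowerBinom b t ℕ.+ 2 ℕ.* twoPowerBinom b (suc t)) ≡⟨ cong +_ (twoPowerBinom-suc-suc b t) ⟨
    + twoPowerBinom (suc b) (suc t)                         ∎

-- Solving the moment recursion

-- For q > n the exponent n ∸ q truncates to 0, and then (h ⊛^ 0) q = one q = 0.
powerDiagonal : Series → ℕ → ℕ → ℤ
powerDiagonal h n q = (h ⊛^ (n ∸ q)) q

powerDiagonal-zero : ∀ h q → powerDiagonal h 0 q ≡ one q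
powerDiagonal-zero h q = cong (λ e → (h ⊛^ e) q) (ℕₚ.0∸n≡0 q)

one-vanish : ∀ {q} → 0 < q → one q ≡ + 0
one-vanish {suc q} _ = refl

powerDiagonal-suc : ∀ h n q →
  powerDiagonal h (suc n) q ≡ Σ< (suc n) (λ ℓ → h ℓ * shiftBy ℓ (powerDiagonal h (n ∸ ℓ)) q)
powerDiagonal-suc h n q with ℕₚ.≤-<-connex q n
... | inj₁ q≤n = begin
  (h ⊛^ (suc n ∸ q)) q
    ≡⟨ cong (λ e → (h ⊛^ e) q) (ℕₚ.+-∸-assoc 1 q≤n) ⟩
  Σ< (suc q) (λ ℓ → h ℓ * (h ⊛^ (n ∸ q)) (q ∸ ℓ))
    ≡⟨ Σ-cong (suc q) (λ ℓ ℓ≤q → cong (h ℓ *_) (term-≤ ℓ (ℕₚ.≤-pred ℓ≤q))) ⟨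
  Σ< (suc q) T
    ≡⟨ Σ-extend T (s≤s q≤n) term-> ⟨
  Σ< (suc n) T ∎
  where
  T : ℕ → ℤ
  T ℓ = h ℓ * shiftBy ℓ (powerDiagonal h (n ∸ ℓ)) q
  term-≤ : ∀ ℓ → ℓ ≤ q → shiftBy ℓ (powerDiagonal h (n ∸ ℓ)) q ≡ (h ⊛^ (n ∸ q)) (q ∸ ℓ)
  term-≤ ℓ ℓ≤q = trans (shiftBy-≤ ℓ (powerDiagonal h (n ∸ ℓ)) ℓ≤q)
                       (cong (λ e → (h ⊛^ e) (q ∸ ℓ)) (trans (ℕₚ.∸-+-assoc n ℓ (q ∸ ℓ)) (cong (n ∸_) (ℕₚ.m+[n∸m]≡n ℓ≤q))))
  term-> : ∀ ℓ → q < ℓ → T ℓ ≡ + 0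
  term-> ℓ q<ℓ = trans (cong (h ℓ *_) (shiftBy-> ℓ (powerDiagonal h (n ∸ ℓ)) q<ℓ)) (*-zeroʳ (h ℓ))
... | inj₂ n<q = begin
  (h ⊛^ (suc n ∸ q)) q       ≡⟨ cong (λ e → (h ⊛^ e) q) (ℕₚ.m≤n⇒m∸n≡0 n<q) ⟩
  one q                      ≡⟨ one-vanish (ℕₚ.<-≤-trans (s≤s z≤n) n<q) ⟩
  + 0                        ≡⟨ Σ-zero (suc n) (λ ℓ ℓ≤n → term (ℕₚ.≤-pred ℓ≤n)) ⟨
  Σ< (suc n) (λ ℓ → h ℓ * shiftBy ℓ (powerDiagonal h (n ∸ ℓ)) q) ∎
  where
  term : ∀ {ℓ} → ℓ ≤ n → h ℓ * shiftBy ℓ (powerDiagonal h (n ∸ ℓ)) q ≡ + 0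
  term {ℓ} ℓ≤n = begin
    h ℓ * shiftBy ℓ (powerDiagonal h (n ∸ ℓ)) q         ≡⟨ cong (h ℓ *_) (shiftBy-≤ ℓ (powerDiagonal h (n ∸ ℓ)) ℓ≤q) ⟩
    h ℓ * (h ⊛^ ((n ∸ ℓ) ∸ (q ∸ ℓ))) (q ∸ ℓ)
      ≡⟨ cong (λ e → h ℓ * (h ⊛^ e) (q ∸ ℓ)) (ℕₚ.m≤n⇒m∸n≡0 (ℕₚ.∸-monoˡ-≤ ℓ (ℕₚ.<⇒≤ n<q))) ⟩
    h ℓ * one (q ∸ ℓ)                                   ≡⟨ cong (h ℓ *_) (one-vanish (ℕₚ.m<n⇒0<n∸m (ℕₚ.≤-<-trans ℓ≤n n<q))) ⟩
    h ℓ * + 0                                           ≡⟨ *-zeroʳ (h ℓ) ⟩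
    + 0                                                 ∎
    where
    ℓ≤q = ℕₚ.<⇒≤ (ℕₚ.≤-<-trans ℓ≤n n<q)

-- Counting words by binomial moments

module _ {A : Set} where

  ΣL : (A → ℤ) → List A → ℤ
  ΣL f []       = + 0
  ΣL f (x ∷ xs) = f x + ΣL f xs

  ΣL-cong : ∀ {f g : A → ℤ} xs → f ≗ g → ΣL f xs ≡ ΣL g xs
  ΣL-cong []       eq = refl
  ΣL-cong (x ∷ xs) eq = cong₂ _+_ (eq x) (ΣL-cong xs eq)

  ΣL-++ : ∀ (f : A → ℤ) xs ys → ΣL f (xs ++ ys) ≡ ΣL f xs + ΣL f ys
  ΣL-++ f []       ys = sym (+-identityˡ (ΣL f ys))
  ΣL-++ f (x ∷ xs) ys = trans (cong (_+_ (f x)) (ΣL-++ f xs ys)) (sym (+-assoc (f x) (ΣL f xs) (ΣL f ys)))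

  ΣL-distrib-+ : ∀ (f g : A → ℤ) xs → ΣL (λ x → f x + g x) xs ≡ ΣL f xs + ΣL g xs
  ΣL-distrib-+ f g []       = refl
  ΣL-distrib-+ f g (x ∷ xs) = trans (cong (_+_ (f x + g x)) (ΣL-distrib-+ f g xs)) (+-interchange (f x) (g x) (ΣL f xs) (ΣL g xs))

  *-distribˡ-ΣL : ∀ c (f : A → ℤ) xs → c * ΣL f xs ≡ ΣL (λ x → c * f x) xs
  *-distribˡ-ΣL c f []       = *-zeroʳ c
  *-distribˡ-ΣL c f (x ∷ xs) = trans (*-distribˡ-+ c (f x) (ΣL f xs)) (cong (_+_ (c * f x)) (*-distribˡ-ΣL c f xs))

  ΣL-Σ-comm : ∀ n (f : A → ℕ → ℤ) xs → ΣL (λ x → Σ< n (f x)) xs ≡ Σ< n (λ i → ΣL (λ x → f x i) xs)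
  ΣL-Σ-comm n f []       = sym (Σ-zero n (λ _ _ → refl))
  ΣL-Σ-comm n f (x ∷ xs) = trans (cong (_+_ (Σ< n (f x))) (ΣL-Σ-comm n f xs)) (sym (Σ-distrib-+ n (f x) (λ i → ΣL (λ x → f x i) xs)))

ΣL-map : ∀ {A B : Set} (f : B → ℤ) (g : A → B) xs → ΣL f (map g xs) ≡ ΣL (f ∘ g) xs
ΣL-map f g []       = refl
ΣL-map f g (x ∷ xs) = cong (_+_ (f (g x))) (ΣL-map f g xs)

ΣL-concatMap : ∀ {A B : Set} (f : B → ℤ) (g : A → List B) xs → ΣL f (concatMap g xs) ≡ ΣL (ΣL f ∘ g) xs
ΣL-concatMap f g []       = refl
ΣL-concatMap f g (x ∷ xs) = trans (ΣL-++ f (g x) (concatMap g xs)) (cong (_+_ (ΣL f (g x))) (ΣL-concatMap f g xs))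

ΣL-tabulate : ∀ {A : Set} n (f : A → ℤ) (g : Fin n → A) (h : ℕ → ℤ) → (∀ i → f (g i) ≡ h (toℕ i)) → ΣL f (tabulate g) ≡ Σ< n h
ΣL-tabulate zero    f g h eq = refl
ΣL-tabulate (suc n) f g h eq = cong₂ _+_ (eq Fin.zero) (ΣL-tabulate n f (g ∘ Fin.suc) (h ∘ suc) (eq ∘ Fin.suc))

ΣL-allFin : ∀ n (f : Fin n → ℤ) (h : ℕ → ℤ) → (∀ i → f i ≡ h (toℕ i)) → ΣL f (List.allFin n) ≡ Σ< n h
ΣL-allFin n f = ΣL-tabulate n f (λ i → i)

ΣL-allWords-suc : ∀ N n (f : Vec (Fin N) (suc n) → ℤ) →
                  ΣL f (allWords N (suc n)) ≡ ΣL (λ x → ΣL (f ∘ (x ∷_)) (allWords N n)) (List.allFin N)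
ΣL-allWords-suc N n f = trans (ΣL-concatMap f (λ x → map (x ∷_) (allWords N n)) (List.allFin N))
                              (ΣL-cong (List.allFin N) (λ x → ΣL-map f (x ∷_) (allWords N n)))

indicator : Bool → ℤ
indicator b = if b then + 1 else + 0

binom-indicator-+ : ∀ b d q → binom ((if b then 1 else 0) ℕ.+ d) (suc q) ≡ binom d (suc q) + indicator b * binom d q
binom-indicator-+ false d q = sym (+-identityʳ (binom d (suc q)))
binom-indicator-+ true  d q = trans (binom-suc-suc d q) (cong (_+_ (binom d (suc q))) (sym (*-identityˡ (binom d q))))

*-distribʳ-ΣL : ∀ {A : Set} c (f : A → ℤ) xs → ΣL f xs * c ≡ ΣL (λ x → f x * c) xs
*-distribʳ-ΣL c f xs = trans (*-comm (ΣL f xs) c) (trans (*-distribˡ-ΣL c f xs) (ΣL-cong xs (λ x → *-comm c (f x))))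

module PairStatistic
  (N : ℕ) (cond : ℕ → ℕ → Bool) (st : ∀ {n} → Vec (Fin N) n → ℕ)
  (st-[] : st [] ≡ 0) (st-[x] : ∀ x → st (x ∷ []) ≡ 0)
  (st-∷∷ : ∀ {n} x y (w : Vec (Fin N) n) →
           st (x ∷ y ∷ w) ≡ (if cond (toℕ x) (toℕ y) then 1 else 0) ℕ.+ st (y ∷ w))
  where

  chains : ℕ → ℕ → ℤ
  chains zero    a = + 1
  chains (suc ℓ) a = Σ< N (λ b → indicator (cond a b) * chains ℓ b)

  chainSeries : Series
  chainSeries ℓ = Σ< N (chains ℓ)

  moment : ℕ → ℕ → ℤ
  moment n q = ΣL (λ w → binom (st w) q) (allWords N n)

  momentFrom : ℕ → Fin N → ℕ → ℤ
  momentFrom n x q = ΣL (λ w → binom (st (x ∷ w)) q) (allWords N n)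

  moment-zero : ∀ q → moment 0 q ≡ one q
  moment-zero q = trans (+-identityʳ (binom (st []) q)) (trans (cong (λ d → binom d q) st-[]) (binom-zero q))

  moment-suc : ∀ n q → moment (suc n) q ≡ ΣL (λ x → momentFrom n x q) (List.allFin N)
  moment-suc n q = ΣL-allWords-suc N n (λ w → binom (st w) q)

  momentFrom-suc-suc : ∀ n x q →
    momentFrom (suc n) x (suc q) ≡ moment (suc n) (suc q) + ΣL (λ y → indicator (cond (toℕ x) (toℕ y)) * momentFrom n y q) (List.allFin N)
  momentFrom-suc-suc n x q = begin
    momentFrom (suc n) x (suc q)
      ≡⟨ ΣL-allWords-suc N n (λ w → binom (st (x ∷ w)) (suc q)) ⟩
    ΣL (λ y → ΣL (λ w → binom (st (x ∷ y ∷ w)) (suc q)) (allWords N n)) (List.allFin N)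
      ≡⟨ ΣL-cong (List.allFin N) split ⟩
    ΣL (λ y → momentFrom n y (suc q) + indicator (c y) * momentFrom n y q) (List.allFin N)
      ≡⟨ ΣL-distrib-+ (λ y → momentFrom n y (suc q)) (λ y → indicator (c y) * momentFrom n y q) (List.allFin N) ⟩
    ΣL (λ y → momentFrom n y (suc q)) (List.allFin N) + ΣL (λ y → indicator (c y) * momentFrom n y q) (List.allFin N)
      ≡⟨ cong (_+ ΣL (λ y → indicator (c y) * momentFrom n y q) (List.allFin N)) (moment-suc n (suc q)) ⟨
    moment (suc n) (suc q) + ΣL (λ y → indicator (c y) * momentFrom n y q) (List.allFin N) ∎
    where
    c : Fin N → Bool
    c y = cond (toℕ x) (toℕ y)
    split : ∀ y → ΣL (λ w → binom (st (x ∷ y ∷ w)) (suc q)) (allWords N n)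
                  ≡ momentFrom n y (suc q) + indicator (c y) * momentFrom n y q
    split y = begin
      ΣL (λ w → binom (st (x ∷ y ∷ w)) (suc q)) (allWords N n)
        ≡⟨ ΣL-cong (allWords N n) (λ w → trans (cong (λ d → binom d (suc q)) (st-∷∷ x y w)) (binom-indicator-+ (c y) (st (y ∷ w)) q)) ⟩
      ΣL (λ w → binom (st (y ∷ w)) (suc q) + indicator (c y) * binom (st (y ∷ w)) q) (allWords N n)
        ≡⟨ ΣL-distrib-+ (λ w → binom (st (y ∷ w)) (suc q)) (λ w → indicator (c y) * binom (st (y ∷ w)) q) (allWords N n) ⟩
      momentFrom n y (suc q) + ΣL (λ w → indicator (c y) * binom (st (y ∷ w)) q) (allWords N n)
        ≡⟨ cong (_+_ (momentFrom n y (suc q))) (*-distribˡ-ΣL (indicator (c y)) (λ w → binom (st (y ∷ w)) q) (allWords N n)) ⟨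
      momentFrom n y (suc q) + indicator (c y) * momentFrom n y q ∎

  momentFrom-chains : ∀ n x q →
    momentFrom n x q ≡ Σ< (suc n) (λ ℓ → chains ℓ (toℕ x) * shiftBy ℓ (moment (n ∸ ℓ)) q)
  momentFrom-chains zero x q = begin
    binom (st (x ∷ [])) q + + 0        ≡⟨ +-identityʳ _ ⟩
    binom (st (x ∷ [])) q              ≡⟨ cong (λ d → binom d q) (st-[x] x) ⟩
    binom 0 q                          ≡⟨ trans (binom-zero q) (sym (moment-zero q)) ⟩
    moment 0 q                         ≡⟨ trans (+-identityʳ (+ 1 * moment 0 q)) (*-identityˡ (moment 0 q)) ⟨
    + 1 * moment 0 q + + 0             ∎
  momentFrom-chains (suc n) x zero = begin
    moment (suc n) 0                                          ≡⟨ +-identityʳ (moment (suc n) 0) ⟨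
    moment (suc n) 0 + + 0
      ≡⟨ cong₂ _+_ (*-identityˡ (moment (suc n) 0)) (Σ-zero (suc n) (λ ℓ _ → *-zeroʳ (chains (suc ℓ) (toℕ x)))) ⟨
    + 1 * moment (suc n) 0 + Σ< (suc n) (λ ℓ → chains (suc ℓ) (toℕ x) * + 0) ∎
  momentFrom-chains (suc n) x (suc q) = begin
    momentFrom (suc n) x (suc q)
      ≡⟨ momentFrom-suc-suc n x q ⟩
    moment (suc n) (suc q) + ΣL (λ y → indicator (cond a (toℕ y)) * momentFrom n y q) (List.allFin N)
      ≡⟨ cong (_+_ (moment (suc n) (suc q))) (ΣL-allFin N _ (λ b → indicator (cond a b) * Σ< (suc n) (λ ℓ → chains ℓ b * S ℓ))
                                                         (λ y → cong (indicator (cond a (toℕ y)) *_) (momentFrom-chains n y q))) ⟩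
    moment (suc n) (suc q) + Σ< N (λ b → indicator (cond a b) * Σ< (suc n) (λ ℓ → chains ℓ b * S ℓ))
      ≡⟨ cong (_+_ (moment (suc n) (suc q)))
              (trans (Σ-cong-≗ N push-indicator) (Σ-comm-factorʳ N (suc n) (λ ℓ b → indicator (cond a b) * chains ℓ b) S)) ⟩
    moment (suc n) (suc q) + Σ< (suc n) (λ ℓ → chains (suc ℓ) a * S ℓ)
      ≡⟨ cong (_+ Σ< (suc n) (λ ℓ → chains (suc ℓ) a * S ℓ)) (*-identityˡ (moment (suc n) (suc q))) ⟨
    + 1 * moment (suc n) (suc q) + Σ< (suc n) (λ ℓ → chains (suc ℓ) a * S ℓ) ∎
    where
    a = toℕ x
    S : ℕ → ℤ
    S ℓ = shiftBy ℓ (moment (n ∸ ℓ)) q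
    push-indicator : ∀ b → indicator (cond a b) * Σ< (suc n) (λ ℓ → chains ℓ b * S ℓ)
                           ≡ Σ< (suc n) (λ ℓ → indicator (cond a b) * chains ℓ b * S ℓ)
    push-indicator b = trans (*-distribˡ-Σ (suc n) (indicator (cond a b)) (λ ℓ → chains ℓ b * S ℓ))
                             (Σ-cong-≗ (suc n) (λ ℓ → sym (*-assoc (indicator (cond a b)) (chains ℓ b) (S ℓ))))

  moment-suc-chains : ∀ n q → moment (suc n) q ≡ Σ< (suc n) (λ ℓ → chainSeries ℓ * shiftBy ℓ (moment (n ∸ ℓ)) q)
  moment-suc-chains n q = begin
    moment (suc n) q                                                ≡⟨ moment-suc n q ⟩
    ΣL (λ x → momentFrom n x q) (List.allFin N)                     ≡⟨ ΣL-allFin N _ _ (λ x → momentFrom-chains n x q) ⟩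
    Σ< N (λ a → Σ< (suc n) (λ ℓ → chains ℓ a * S ℓ))               ≡⟨ Σ-comm-factorʳ N (suc n) chains S ⟩
    Σ< (suc n) (λ ℓ → chainSeries ℓ * S ℓ)                          ∎
    where
    S : ℕ → ℤ
    S ℓ = shiftBy ℓ (moment (n ∸ ℓ)) q

  moment≡powerDiagonal : ∀ n q → moment n q ≡ powerDiagonal chainSeries n q
  moment≡powerDiagonal = <-rec (λ n → ∀ q → moment n q ≡ powerDiagonal chainSeries n q) step
    where
    step : ∀ n → (∀ {m} → m < n → ∀ q → moment m q ≡ powerDiagonal chainSeries m q) →
           ∀ q → moment n q ≡ powerDiagonal chainSeries n q
    step zero    _  q = trans (moment-zero q) (sym (powerDiagonal-zero chainSeries q))
    step (suc n) ih q = begin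
      moment (suc n) q
        ≡⟨ moment-suc-chains n q ⟩
      Σ< (suc n) (λ ℓ → chainSeries ℓ * shiftBy ℓ (moment (n ∸ ℓ)) q)
        ≡⟨ Σ-cong-≗ (suc n) (λ ℓ → cong (chainSeries ℓ *_) (shiftBy-cong ℓ (ih (s≤s (ℕₚ.m∸n≤m n ℓ))) q)) ⟩
      Σ< (suc n) (λ ℓ → chainSeries ℓ * shiftBy ℓ (powerDiagonal chainSeries (n ∸ ℓ)) q)
        ≡⟨ powerDiagonal-suc chainSeries n q ⟨
      powerDiagonal chainSeries (suc n) q ∎

  st-bound : ∀ {n} (w : Vec (Fin N) n) → st w ≤ n
  st-bound []          = ℕₚ.≤-reflexive st-[]
  st-bound (x ∷ [])    = ℕₚ.≤-trans (ℕₚ.≤-reflexive (st-[x] x)) z≤n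
  st-bound (x ∷ y ∷ w) = ℕₚ.≤-trans (ℕₚ.≤-reflexive (st-∷∷ x y w)) (step (cond (toℕ x) (toℕ y)) (st-bound (y ∷ w)))
    where
    step : ∀ b {m n} → m ≤ n → (if b then 1 else 0) ℕ.+ m ≤ suc n
    step true  m≤n = s≤s m≤n
    step false m≤n = ℕₚ.m≤n⇒m≤1+n m≤n

  length-filter : ∀ {n} p (ws : List (Vec (Fin N) n)) →
                  + length (filter (λ w → st w ℕ.≟ p) ws) ≡ ΣL (λ w → eqIndicator (st w) p) ws
  length-filter p []       = refl
  length-filter p (w ∷ ws) with does (st w ℕ.≟ p)
  ... | true  = trans (pos-+ 1 _) (cong (_+_ (+ 1)) (length-filter p ws))
  ... | false = trans (length-filter p ws) (sym (+-identityˡ _))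

  countWords≡Σ-moments : ∀ n p → + countWords N n st p ≡ Σ< (suc n) (λ q → moment n q * binom⁻¹ q p)
  countWords≡Σ-moments n p = begin
    + countWords N n st p
      ≡⟨ length-filter p (allWords N n) ⟩
    ΣL (λ w → eqIndicator (st w) p) (allWords N n)
      ≡⟨ ΣL-cong (allWords N n) (λ w → invert (st w) (st-bound w)) ⟩
    ΣL (λ w → Σ< (suc n) (λ q → binom (st w) q * binom⁻¹ q p)) (allWords N n)
      ≡⟨ ΣL-Σ-comm (suc n) (λ w q → binom (st w) q * binom⁻¹ q p) (allWords N n) ⟩
    Σ< (suc n) (λ q → ΣL (λ w → binom (st w) q * binom⁻¹ q p) (allWords N n))
      ≡⟨ Σ-cong-≗ (suc n) (λ q → *-distribʳ-ΣL (binom⁻¹ q p) (λ w → binom (st w) q) (allWords N n)) ⟨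
    Σ< (suc n) (λ q → moment n q * binom⁻¹ q p) ∎
    where
    invert : ∀ d → d ≤ n → eqIndicator d p ≡ Σ< (suc n) (λ q → binom d q * binom⁻¹ q p)
    invert d d≤n = sym (trans (Σ-extend (λ q → binom d q * binom⁻¹ q p) (s≤s d≤n)
                                        (λ q d<q → trans (cong (_* binom⁻¹ q p) (binom-vanish d<q)) (*-zeroˡ (binom⁻¹ q p))))
                              (binomial-inversion d p))

  countWords≡Σ-chainPowers : ∀ n p →
    + countWords N n st p ≡ Σ< (suc n) (λ m → (chainSeries ⊛^ m) (n ∸ m) * binom⁻¹ (n ∸ m) p)
  countWords≡Σ-chainPowers n p = begin
    + countWords N n st p
      ≡⟨ countWords≡Σ-moments n p ⟩
    Σ< (suc n) (λ q → moment n q * binom⁻¹ q p)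
      ≡⟨ Σ-cong-≗ (suc n) (λ q → cong (_* binom⁻¹ q p) (moment≡powerDiagonal n q)) ⟩
    Σ< (suc n) (λ q → powerDiagonal chainSeries n q * binom⁻¹ q p)
      ≡⟨ Σ-reverse (suc n) (λ q → powerDiagonal chainSeries n q * binom⁻¹ q p) ⟨
    Σ< (suc n) (λ m → powerDiagonal chainSeries n (n ∸ m) * binom⁻¹ (n ∸ m) p)
      ≡⟨ Σ-cong (suc n) (λ m m≤n → cong (λ e → (chainSeries ⊛^ e) (n ∸ m) * binom⁻¹ (n ∸ m) p)
                                        (ℕₚ.m∸[m∸n]≡n (ℕₚ.≤-pred m≤n))) ⟩
    Σ< (suc n) (λ m → (chainSeries ⊛^ m) (n ∸ m) * binom⁻¹ (n ∸ m) p) ∎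

-- Chains of odd-letter descents and rises

double : ℕ → ℕ
double zero    = zero
double (suc r) = suc (suc (double r))

isOdd-suc-double : ∀ i → isOdd (suc (double i)) ≡ true
isOdd-suc-double zero    = refl
isOdd-suc-double (suc i) = isOdd-suc-double i

isOdd-double : ∀ i → isOdd (double i) ≡ false
isOdd-double zero    = refl
isOdd-double (suc i) = isOdd-double i

isOdd-reflect : ∀ r a → a ≤ double r → isOdd (suc (double r ∸ a)) ≡ isOdd (suc a)
isOdd-reflect r       zero          _                 = isOdd-suc-double r
isOdd-reflect (suc r) (suc zero)    _                 = isOdd-double r
isOdd-reflect (suc r) (suc (suc a)) (s≤s (s≤s a≤2r)) = isOdd-reflect r a a≤2r

<ᵇ-true : ∀ {b a} → b < a → (b <ᵇ a) ≡ true
<ᵇ-true {zero}  {suc a} _         = refl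
<ᵇ-true {suc b} {suc a} (s≤s b<a) = <ᵇ-true b<a

<ᵇ-false : ∀ {b a} → a ≤ b → (b <ᵇ a) ≡ false
<ᵇ-false {b}     {zero}  _         = refl
<ᵇ-false {suc b} {suc a} (s≤s a≤b) = <ᵇ-false a≤b

<ᵇ-∸-swap : ∀ {D a i} → a ≤ D → i ≤ D → (a <ᵇ D ∸ i) ≡ (i <ᵇ D ∸ a)
<ᵇ-∸-swap {D} {a} {i} a≤D i≤D with ℕₚ.<-≤-connex (a ℕ.+ i) D
... | inj₁ a+i<D = trans (<ᵇ-true (ℕₚ.m+n≤o⇒m≤o∸n (suc a) a+i<D))
                         (sym (<ᵇ-true (ℕₚ.m+n≤o⇒m≤o∸n (suc i) (subst (λ s → suc s ≤ D) (ℕₚ.+-comm a i) a+i<D))))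
... | inj₂ D≤a+i = trans (<ᵇ-false (ℕₚ.m≤n+o⇒m∸n≤o D i (subst (D ≤_) (ℕₚ.+-comm a i) D≤a+i)))
                         (sym (<ᵇ-false (ℕₚ.m≤n+o⇒m∸n≤o D a D≤a+i)))

indicator-∧ : ∀ x y → indicator (x ∧ y) ≡ indicator x * indicator y
indicator-∧ true  y = sym (*-identityˡ (indicator y))
indicator-∧ false y = refl

Σ-below : ∀ M a (f : ℕ → ℤ) → a ≤ M → Σ< M (λ b → indicator (b <ᵇ a) * f b) ≡ Σ< a f
Σ-below M a f a≤M = begin
  Σ< M g                                          ≡⟨ Σ-extend g a≤M (λ b a≤b → cong (λ x → indicator x * f b) (<ᵇ-false a≤b)) ⟩
  Σ< a g                                          ≡⟨ Σ-cong a (λ b b<a → trans (cong (λ x → indicator x * f b) (<ᵇ-true b<a)) (*-identityˡ (f b))) ⟩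
  Σ< a f                                          ∎
  where
  g : ℕ → ℤ
  g b = indicator (b <ᵇ a) * f b

Σ-pairs : ∀ r (f : ℕ → ℤ) → Σ< (double r) f ≡ Σ< r (λ i → f (double i) + f (suc (double i)))
Σ-pairs zero    f = refl
Σ-pairs (suc r) f = trans (cong (λ s → f 0 + (f 1 + s)) (Σ-pairs r (f ∘ suc ∘ suc))) (sym (+-assoc (f 0) (f 1) _))

oddChainSeries : ℕ → Series
oddChainSeries k ℓ = + 2 * binom (suc k) (suc ℓ) - one ℓ

module OddLetterChains (k : ℕ) where

  N : ℕ
  N = 2 ℕ.* k ℕ.+ 1

  D : ℕ
  D = double k

  N≡1+D : N ≡ suc D
  N≡1+D = trans (ℕₚ.+-comm (2 ℕ.* k) 1) (cong suc (sym (double≡2* k)))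
    where
    double≡2* : ∀ r → double r ≡ 2 ℕ.* r
    double≡2* zero    = refl
    double≡2* (suc r) = trans (cong (suc ∘ suc) (double≡2* r)) (sym (ℕₚ.*-suc 2 r))

  Σ<N : ∀ f → Σ< N f ≡ Σ< (suc D) f
  Σ<N f = cong (λ M → Σ< M f) N≡1+D

  -- Arguments are indices: index a stands for the letter a + 1.
  condDes condRis : ℕ → ℕ → Bool
  condDes a b = isOdd (suc a) ∧ (b <ᵇ a)
  condRis a b = isOdd (suc a) ∧ (a <ᵇ b)

  module Des = PairStatistic N condDes desO refl (λ _ → refl) (λ _ _ _ → refl)
  module Ris = PairStatistic N condRis risO refl (λ _ → refl) (λ _ _ _ → refl)

  des-chains-suc : ∀ ℓ a → a ≤ N → Des.chains (suc ℓ) a ≡ indicator (isOdd (suc a)) * Σ< a (Des.chains ℓ)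
  des-chains-suc ℓ a a≤N = begin
    Σ< N (λ b → indicator (isOdd (suc a) ∧ (b <ᵇ a)) * Des.chains ℓ b)
      ≡⟨ Σ-cong-≗ N (λ b → trans (cong (_* Des.chains ℓ b) (indicator-∧ (isOdd (suc a)) (b <ᵇ a)))
                                 (*-assoc (indicator (isOdd (suc a))) (indicator (b <ᵇ a)) (Des.chains ℓ b))) ⟩
    Σ< N (λ b → indicator (isOdd (suc a)) * (indicator (b <ᵇ a) * Des.chains ℓ b))
      ≡⟨ *-distribˡ-Σ N (indicator (isOdd (suc a))) (λ b → indicator (b <ᵇ a) * Des.chains ℓ b) ⟨
    indicator (isOdd (suc a)) * Σ< N (λ b → indicator (b <ᵇ a) * Des.chains ℓ b)
      ≡⟨ cong (indicator (isOdd (suc a)) *_) (Σ-below N a (Des.chains ℓ) a≤N) ⟩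
    indicator (isOdd (suc a)) * Σ< a (Des.chains ℓ) ∎

  D≤N : D ≤ N
  D≤N = subst (D ≤_) (sym N≡1+D) (ℕₚ.n≤1+n D)

  mutual
    des-chains-pair : ∀ ℓ i → i < k → Des.chains ℓ (double i) + Des.chains ℓ (suc (double i)) ≡ + 2 * binom i ℓ
    des-chains-pair zero    i _   = refl
    des-chains-pair (suc ℓ) i i<k = begin
      Des.chains (suc ℓ) (double i) + Des.chains (suc ℓ) (suc (double i))
        ≡⟨ cong₂ _+_ (des-chains-suc ℓ (double i) (ℕₚ.≤-trans (ℕₚ.n≤1+n _) 2i+1≤N)) (des-chains-suc ℓ (suc (double i)) 2i+1≤N) ⟩
      indicator (isOdd (suc (double i))) * Σ< (double i) (Des.chains ℓ) + indicator (isOdd (double i)) * Σ< (suc (double i)) (Des.chains ℓ)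
        ≡⟨ cong₂ (λ x y → indicator x * Σ< (double i) (Des.chains ℓ) + indicator y * Σ< (suc (double i)) (Des.chains ℓ))
                 (isOdd-suc-double i) (isOdd-double i) ⟩
      + 1 * Σ< (double i) (Des.chains ℓ) + + 0
        ≡⟨ trans (+-identityʳ _) (*-identityˡ _) ⟩
      Σ< (double i) (Des.chains ℓ)
        ≡⟨ des-chains-prefix ℓ i (ℕₚ.<⇒≤ i<k) ⟩
      + 2 * binom i (suc ℓ) ∎
      where
      2i+1≤N : suc (double i) ≤ N
      2i+1≤N = ℕₚ.≤-trans (ℕₚ.≤-trans (ℕₚ.n≤1+n _) (double-< i<k)) D≤N
        where
        double-< : ∀ {i j} → i < j → suc (suc (double i)) ≤ double j
        double-< {zero}  {suc j} _         = s≤s (s≤s z≤n)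
        double-< {suc i} {suc j} (s≤s i<j) = s≤s (s≤s (double-< i<j))

    des-chains-prefix : ∀ ℓ r → r ≤ k → Σ< (double r) (Des.chains ℓ) ≡ + 2 * binom r (suc ℓ)
    des-chains-prefix ℓ r r≤k = begin
      Σ< (double r) (Des.chains ℓ)                                          ≡⟨ Σ-pairs r (Des.chains ℓ) ⟩
      Σ< r (λ i → Des.chains ℓ (double i) + Des.chains ℓ (suc (double i)))  ≡⟨ Σ-cong r (λ i i<r → des-chains-pair ℓ i (ℕₚ.<-≤-trans i<r r≤k)) ⟩
      Σ< r (λ i → + 2 * binom i ℓ)                                          ≡⟨ *-distribˡ-Σ r (+ 2) (λ i → binom i ℓ) ⟨
      + 2 * Σ< r (λ i → binom i ℓ)                                          ≡⟨ cong (+ 2 *_) (Σ-hockey-stick r ℓ) ⟩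
      + 2 * binom r (suc ℓ)                                                 ∎

  des-chainSeries : Des.chainSeries ≗ oddChainSeries k
  des-chainSeries ℓ = begin
    Σ< N (Des.chains ℓ)                          ≡⟨ Σ<N (Des.chains ℓ) ⟩
    Σ< (suc D) (Des.chains ℓ)                    ≡⟨ Σ-init-last D (Des.chains ℓ) ⟩
    Σ< D (Des.chains ℓ) + Des.chains ℓ D         ≡⟨ cong (_+ Des.chains ℓ D) (des-chains-prefix ℓ k ℕₚ.≤-refl) ⟩
    + 2 * binom k (suc ℓ) + Des.chains ℓ D       ≡⟨ top ℓ ⟩
    oddChainSeries k ℓ                           ∎
    where
    top : ∀ ℓ → + 2 * binom k (suc ℓ) + Des.chains ℓ D ≡ oddChainSeries k ℓ
    top zero = begin
      + 2 * binom k 1 + + 1                   ≡⟨ rearrange (binom k 1) ⟩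
      + 2 * (binom k 1 + + 1) - + 1           ≡⟨ cong (λ b → + 2 * b - + 1) (binom-suc-suc k 0) ⟨
      oddChainSeries k 0                      ∎
      where
      rearrange : ∀ b → + 2 * b + + 1 ≡ + 2 * (b + + 1) - + 1
      rearrange = solve-∀
    top (suc ℓ) = begin
      + 2 * binom k (suc (suc ℓ)) + Des.chains (suc ℓ) D
        ≡⟨ cong (_+_ (+ 2 * binom k (suc (suc ℓ)))) (des-chains-suc ℓ D D≤N) ⟩
      + 2 * binom k (suc (suc ℓ)) + indicator (isOdd (suc D)) * Σ< D (Des.chains ℓ)
        ≡⟨ cong₂ (λ x s → + 2 * binom k (suc (suc ℓ)) + indicator x * s) (isOdd-suc-double k) (des-chains-prefix ℓ k ℕₚ.≤-refl) ⟩
      + 2 * binom k (suc (suc ℓ)) + + 1 * (+ 2 * binom k (suc ℓ))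
        ≡⟨ rearrange (binom k (suc (suc ℓ))) (binom k (suc ℓ)) ⟩
      + 2 * (binom k (suc (suc ℓ)) + binom k (suc ℓ)) - + 0
        ≡⟨ cong (λ b → + 2 * b - + 0) (binom-suc-suc k (suc ℓ)) ⟨
      oddChainSeries k (suc ℓ) ∎
      where
      rearrange : ∀ b c → + 2 * b + + 1 * (+ 2 * c) ≡ + 2 * (b + c) - + 0
      rearrange = solve-∀

  ris-chains : ∀ ℓ a → a ≤ D → Ris.chains ℓ a ≡ Des.chains ℓ (D ∸ a)
  ris-chains zero    a _   = refl
  ris-chains (suc ℓ) a a≤D = begin
    Σ< N (λ b → indicator (condRis a b) * Ris.chains ℓ b)
      ≡⟨ Σ<N (λ b → indicator (condRis a b) * Ris.chains ℓ b) ⟩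
    Σ< (suc D) (λ b → indicator (condRis a b) * Ris.chains ℓ b)
      ≡⟨ Σ-cong (suc D) (λ b b≤D → cong (indicator (condRis a b) *_) (ris-chains ℓ b (ℕₚ.≤-pred b≤D))) ⟩
    Σ< (suc D) (λ b → indicator (condRis a b) * Des.chains ℓ (D ∸ b))
      ≡⟨ Σ-reverse (suc D) (λ b → indicator (condRis a b) * Des.chains ℓ (D ∸ b)) ⟨
    Σ< (suc D) (λ i → indicator (condRis a (D ∸ i)) * Des.chains ℓ (D ∸ (D ∸ i)))
      ≡⟨ Σ-cong (suc D) (λ i i≤D → reflect i (ℕₚ.≤-pred i≤D)) ⟩
    Σ< (suc D) (λ i → indicator (condDes (D ∸ a) i) * Des.chains ℓ i)
      ≡⟨ Σ<N (λ i → indicator (condDes (D ∸ a) i) * Des.chains ℓ i) ⟨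
    Des.chains (suc ℓ) (D ∸ a) ∎
    where
    reflect : ∀ i → i ≤ D → indicator (condRis a (D ∸ i)) * Des.chains ℓ (D ∸ (D ∸ i))
                            ≡ indicator (condDes (D ∸ a) i) * Des.chains ℓ i
    reflect i i≤D = cong₂ (λ x j → indicator x * Des.chains ℓ j)
                          (cong₂ _∧_ (sym (isOdd-reflect k a a≤D)) (<ᵇ-∸-swap a≤D i≤D))
                          (ℕₚ.m∸[m∸n]≡n i≤D)

  ris-chainSeries : Ris.chainSeries ≗ oddChainSeries k
  ris-chainSeries ℓ = begin
    Σ< N (Ris.chains ℓ)                     ≡⟨ Σ<N (Ris.chains ℓ) ⟩
    Σ< (suc D) (Ris.chains ℓ)               ≡⟨ Σ-cong (suc D) (λ a a≤D → ris-chains ℓ a (ℕₚ.≤-pred a≤D)) ⟩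
    Σ< (suc D) (λ a → Des.chains ℓ (D ∸ a)) ≡⟨ Σ-reverse (suc D) (Des.chains ℓ) ⟩
    Σ< (suc D) (Des.chains ℓ)               ≡⟨ Σ<N (Des.chains ℓ) ⟨
    Des.chainSeries ℓ                       ≡⟨ des-chainSeries ℓ ⟩
    oddChainSeries k ℓ                      ∎

-- The triple sum

pos-^ : ∀ a j → + (a ℕ.^ j) ≡ (+ a) ^ j
pos-^ a zero    = refl
pos-^ a (suc j) = trans (pos-* a (a ℕ.^ j)) (cong (+ a *_) (pos-^ a j))

shift-oddChainSeries : ∀ k → shift (oddChainSeries k) ≗ + 2 • binom (suc k) ⊕ - + 1 • twoPlusX
shift-oddChainSeries k zero    = refl
shift-oddChainSeries k (suc ℓ) = regroup (+ 2 * binom (suc k) (suc ℓ)) (one ℓ)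
  where
  regroup : ∀ x y → x - y ≡ x + - + 1 * (+ 2 * + 0 + y)
  regroup = solve-∀

binom-⊛^-suc : ∀ k j → binom (suc k) ⊛^ j ≗ binom (j ℕ.* k ℕ.+ j)
binom-⊛^-suc k j n = trans (binom-⊛^ (suc k) j n) (cong (λ a → binom a n) (index j k))
  where
  index : ∀ j k → j ℕ.* suc k ≡ j ℕ.* k ℕ.+ j
  index = ℕ-Solver.solve-∀

oddChainSeries-⊛^ : ∀ k m n → m ≤ n →
  (oddChainSeries k ⊛^ m) (n ∸ m)
  ≡ Σ< (suc m) (λ j → binom m j * ((+ 2) ^ j * (sign (m ∸ j) * (binom (j ℕ.* k ℕ.+ j) ⊛ twoPlusX ⊛^ (m ∸ j)) n)))
oddChainSeries-⊛^ k m n m≤n = begin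
  (oddChainSeries k ⊛^ m) (n ∸ m)               ≡⟨ shiftBy-≤ m (oddChainSeries k ⊛^ m) m≤n ⟨
  shiftBy m (oddChainSeries k ⊛^ m) n           ≡⟨ shift-⊛^ (oddChainSeries k) m n ⟨
  (shift (oddChainSeries k) ⊛^ m) n             ≡⟨ ⊛^-cong m (shift-oddChainSeries k) n ⟩
  ((+ 2 • binom (suc k) ⊕ - + 1 • twoPlusX) ⊛^ m) n
                                                ≡⟨ ⊛^-binomial (+ 2 • binom (suc k)) (- + 1 • twoPlusX) m n ⟩
  Σ< (suc m) (λ j → binom m j * ((+ 2 • binom (suc k)) ⊛^ j ⊛ (- + 1 • twoPlusX) ⊛^ (m ∸ j)) n)
    ≡⟨ Σ-cong-≗ (suc m) (λ j → cong (binom m j *_) (term j)) ⟩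
  Σ< (suc m) (λ j → binom m j * ((+ 2) ^ j * (sign (m ∸ j) * (binom (j ℕ.* k ℕ.+ j) ⊛ twoPlusX ⊛^ (m ∸ j)) n))) ∎
  where
  term : ∀ j → ((+ 2 • binom (suc k)) ⊛^ j ⊛ (- + 1 • twoPlusX) ⊛^ (m ∸ j)) n
               ≡ (+ 2) ^ j * (sign (m ∸ j) * (binom (j ℕ.* k ℕ.+ j) ⊛ twoPlusX ⊛^ (m ∸ j)) n)
  term j = begin
    ((+ 2 • binom (suc k)) ⊛^ j ⊛ (- + 1 • twoPlusX) ⊛^ (m ∸ j)) n
      ≡⟨ ⊛-cong (•-⊛^ (+ 2) (binom (suc k)) j) (•-⊛^ (- + 1) twoPlusX (m ∸ j)) n ⟩
    (((+ 2) ^ j • B) ⊛ ((- + 1) ^ (m ∸ j) • T)) n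
      ≡⟨ •-⊛ ((+ 2) ^ j) B ((- + 1) ^ (m ∸ j) • T) n ⟩
    (+ 2) ^ j * (B ⊛ ((- + 1) ^ (m ∸ j) • T)) n
      ≡⟨ cong ((+ 2) ^ j *_) (⊛-• ((- + 1) ^ (m ∸ j)) B T n) ⟩
    (+ 2) ^ j * ((- + 1) ^ (m ∸ j) * (B ⊛ T) n)
      ≡⟨ cong₂ (λ s c → (+ 2) ^ j * (s * c)) (-1^≡sign (m ∸ j)) (⊛-cong {g = T} (binom-⊛^-suc k j) (λ _ → refl) n) ⟩
    (+ 2) ^ j * (sign (m ∸ j) * (binom (j ℕ.* k ℕ.+ j) ⊛ T) n) ∎
    where
    B = binom (suc k) ⊛^ j
    T = twoPlusX ⊛^ (m ∸ j)

binomℤ-≤ : ∀ a {n i} → i ≤ n → binomℤ a (+ n - + i) ≡ a C (n ∸ i)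
binomℤ-≤ a {n} {i} i≤n = cong (binomℤ a) (trans (m-n≡m⊖n n i) (⊖-≥ i≤n))

binomℤ-> : ∀ a {n i} → n < i → binomℤ a (+ n - + i) ≡ 0
binomℤ-> a {n} {i} n<i = cong (binomℤ a) (trans (m-n≡m⊖n n i) (trans (⊖-< n<i) (cong (λ d → - + d) (ℕₚ.+-∸-assoc 1 n<i))))

two-power-split : ∀ {m n i j} → i ≤ n → j ≤ m →
  2 ℕ.^ ((m ℕ.+ i) ∸ n) ℕ.* ((m ∸ j) C (n ∸ i)) ≡ 2 ℕ.^ j ℕ.* twoPowerBinom (m ∸ j) (n ∸ i)
two-power-split {m} {n} {i} {j} i≤n j≤m with ℕₚ.≤-<-connex (n ∸ i) (m ∸ j)
... | inj₁ b≤a = begin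
  2 ℕ.^ ((m ℕ.+ i) ∸ n) ℕ.* c                            ≡⟨ cong (λ e → 2 ℕ.^ e ℕ.* c) exponent ⟩
  2 ℕ.^ (j ℕ.+ (a ∸ b)) ℕ.* c                            ≡⟨ cong (ℕ._* c) (ℕₚ.^-distribˡ-+-* 2 j (a ∸ b)) ⟩
  2 ℕ.^ j ℕ.* 2 ℕ.^ (a ∸ b) ℕ.* c                        ≡⟨ ℕₚ.*-assoc (2 ℕ.^ j) (2 ℕ.^ (a ∸ b)) c ⟩
  2 ℕ.^ j ℕ.* (2 ℕ.^ (a ∸ b) ℕ.* c)                      ∎
  where
  a = m ∸ j
  b = n ∸ i
  c = a C b
  exponent : (m ℕ.+ i) ∸ n ≡ j ℕ.+ (a ∸ b)
  exponent = begin
    (m ℕ.+ i) ∸ n                   ≡⟨ cong₂ (λ x y → (x ℕ.+ i) ∸ y) (ℕₚ.m+[n∸m]≡n j≤m) (ℕₚ.m+[n∸m]≡n i≤n) ⟨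
    (j ℕ.+ a ℕ.+ i) ∸ (i ℕ.+ b)     ≡⟨ cong (_∸ (i ℕ.+ b)) (ℕₚ.+-comm (j ℕ.+ a) i) ⟩
    (i ℕ.+ (j ℕ.+ a)) ∸ (i ℕ.+ b)   ≡⟨ ℕₚ.[m+n]∸[m+o]≡n∸o i (j ℕ.+ a) b ⟩
    (j ℕ.+ a) ∸ b                   ≡⟨ ℕₚ.+-∸-assoc j b≤a ⟩
    j ℕ.+ (a ∸ b)                   ∎
... | inj₂ a<b rewrite k>n⇒nCk≡0 a<b = both-zero (2 ℕ.^ ((m ℕ.+ i) ∸ n)) (2 ℕ.^ j) (2 ℕ.^ ((m ∸ j) ∸ (n ∸ i)))
  where
  both-zero : ∀ x y z → x ℕ.* 0 ≡ y ℕ.* (z ℕ.* 0)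
  both-zero = ℕ-Solver.solve-∀

sign-split : ∀ {n p m j} → j ≤ m → m ≤ n → sign (n ℕ.+ p ℕ.+ j) ≡ sign (m ∸ j) * sign ((n ∸ m) ℕ.+ p)
sign-split {n} {p} {m} {j} j≤m m≤n = begin
  sign (n ℕ.+ p ℕ.+ j)                                 ≡⟨ cong (λ x → sign (x ℕ.+ p ℕ.+ j)) (ℕₚ.m+[n∸m]≡n m≤n) ⟨
  sign (m ℕ.+ (n ∸ m) ℕ.+ p ℕ.+ j)                     ≡⟨ cong (λ x → sign (x ℕ.+ (n ∸ m) ℕ.+ p ℕ.+ j)) (ℕₚ.m∸n+n≡m j≤m) ⟨
  sign ((m ∸ j) ℕ.+ j ℕ.+ (n ∸ m) ℕ.+ p ℕ.+ j)         ≡⟨ cong sign (regroup (m ∸ j) j (n ∸ m) p) ⟩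
  sign ((m ∸ j) ℕ.+ ((n ∸ m) ℕ.+ p) ℕ.+ (j ℕ.+ j))     ≡⟨ sign-+-double ((m ∸ j) ℕ.+ ((n ∸ m) ℕ.+ p)) j ⟩
  sign ((m ∸ j) ℕ.+ ((n ∸ m) ℕ.+ p))                   ≡⟨ sign-+ (m ∸ j) ((n ∸ m) ℕ.+ p) ⟩
  sign (m ∸ j) * sign ((n ∸ m) ℕ.+ p)                  ∎
  where
  regroup : ∀ a j d p → a ℕ.+ j ℕ.+ d ℕ.+ p ℕ.+ j ≡ a ℕ.+ (d ℕ.+ p) ℕ.+ (j ℕ.+ j)
  regroup = ℕ-Solver.solve-∀

module _ (k n p m j : ℕ) (j≤m : j ≤ m) (m≤n : m ≤ n) where

  private
    e : ℕ → ℕ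
    e i = (m ℕ.+ i) ∸ n
    T : Series
    T = twoPlusX ⊛^ (m ∸ j)
    s : ℤ
    s = sign (n ℕ.+ p ℕ.+ j)

  summand-in-ℤ : ∀ i → summand k n p m j i
                       ≡ s * (+ (2 ℕ.^ e i) * binom m j * + binomℤ (m ∸ j) (+ n - + i) * binom (j ℕ.* k ℕ.+ j) i * binom (n ∸ m) p)
  summand-in-ℤ i = cong (s *_) (pos-*⁵ (2 ℕ.^ e i) (m C j) (binomℤ (m ∸ j) (+ n - + i)) ((j ℕ.* k ℕ.+ j) C i) ((n ∸ m) C p))
    where
    pos-*⁵ : ∀ a b c d f → + (a ℕ.* b ℕ.* c ℕ.* d ℕ.* f) ≡ + a * + b * + c * + d * + f
    pos-*⁵ a b c d f = trans (pos-* (a ℕ.* b ℕ.* c ℕ.* d) f) (cong (_* + f)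
                         (trans (pos-* (a ℕ.* b ℕ.* c) d) (cong (_* + d)
                           (trans (pos-* (a ℕ.* b) c) (cong (_* + c) (pos-* a b))))))

  two-power-coefficient : ∀ i → i ≤ n → + (2 ℕ.^ e i) * + ((m ∸ j) C (n ∸ i)) ≡ (+ 2) ^ j * T (n ∸ i)
  two-power-coefficient i i≤n = begin
    + (2 ℕ.^ e i) * + ((m ∸ j) C (n ∸ i))                              ≡⟨ pos-* (2 ℕ.^ e i) _ ⟨
    + (2 ℕ.^ e i ℕ.* ((m ∸ j) C (n ∸ i)))                              ≡⟨ cong +_ (two-power-split i≤n j≤m) ⟩
    + (2 ℕ.^ j ℕ.* twoPowerBinom (m ∸ j) (n ∸ i))                      ≡⟨ pos-* (2 ℕ.^ j) _ ⟩
    + (2 ℕ.^ j) * + twoPowerBinom (m ∸ j) (n ∸ i)                      ≡⟨ cong₂ _*_ (sym (pos-^ 2 j)) (twoPlusX-⊛^ (m ∸ j) (n ∸ i)) ⟨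
    (+ 2) ^ j * T (n ∸ i)                                               ∎

  summand-factor : ℤ
  summand-factor = binom m j * (+ 2) ^ j * sign (m ∸ j) * binom⁻¹ (n ∸ m) p

  summand-factorises : ∀ i → i ≤ n → summand k n p m j i ≡ summand-factor * (binom (j ℕ.* k ℕ.+ j) i * T (n ∸ i))
  summand-factorises i i≤n = begin
    summand k n p m j i
      ≡⟨ summand-in-ℤ i ⟩
    s * (A * B * + binomℤ (m ∸ j) (+ n - + i) * D * E)
      ≡⟨ cong₂ (λ s′ x → s′ * (A * B * + x * D * E)) (sign-split j≤m m≤n) (binomℤ-≤ (m ∸ j) i≤n) ⟩
    sign (m ∸ j) * sign ((n ∸ m) ℕ.+ p) * (A * B * + ((m ∸ j) C (n ∸ i)) * D * E)
      ≡⟨ regroup (sign (m ∸ j)) (sign ((n ∸ m) ℕ.+ p)) A B (+ ((m ∸ j) C (n ∸ i))) D E ⟩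
    sign (m ∸ j) * sign ((n ∸ m) ℕ.+ p) * B * D * E * (A * + ((m ∸ j) C (n ∸ i)))
      ≡⟨ cong (sign (m ∸ j) * sign ((n ∸ m) ℕ.+ p) * B * D * E *_) (two-power-coefficient i i≤n) ⟩
    sign (m ∸ j) * sign ((n ∸ m) ℕ.+ p) * B * D * E * ((+ 2) ^ j * T (n ∸ i))
      ≡⟨ rearrange (sign (m ∸ j)) (sign ((n ∸ m) ℕ.+ p)) B D E ((+ 2) ^ j) (T (n ∸ i)) ⟩
    summand-factor * (D * T (n ∸ i)) ∎
    where
    A = + (2 ℕ.^ e i)
    B = binom m j
    D = binom (j ℕ.* k ℕ.+ j) i
    E = binom (n ∸ m) p
    regroup : ∀ s₁ s₂ a b x d f → s₁ * s₂ * (a * b * x * d * f) ≡ s₁ * s₂ * b * d * f * (a * x)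
    regroup = solve-∀
    rearrange : ∀ s₁ s₂ b d f q t → s₁ * s₂ * b * d * f * (q * t) ≡ b * q * s₁ * (s₂ * f) * (d * t)
    rearrange = solve-∀

  summand-vanish-n : ∀ i → n < i → summand k n p m j i ≡ + 0
  summand-vanish-n i n<i = begin
    summand k n p m j i
      ≡⟨ summand-in-ℤ i ⟩
    s * (A * B * + binomℤ (m ∸ j) (+ n - + i) * D * E)
      ≡⟨ cong (λ x → s * (A * B * + x * D * E)) (binomℤ-> (m ∸ j) n<i) ⟩
    s * (A * B * + 0 * D * E)
      ≡⟨ annihilate s A B D E ⟩
    + 0 ∎
    where
    A = + (2 ℕ.^ e i)
    B = binom m j
    D = binom (j ℕ.* k ℕ.+ j) i
    E = binom (n ∸ m) p
    annihilate : ∀ s a b d f → s * (a * b * + 0 * d * f) ≡ + 0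
    annihilate = solve-∀

  summand-vanish-k : ∀ i → k ℕ.* j ℕ.+ j < i → summand k n p m j i ≡ + 0
  summand-vanish-k i bound<i = begin
    summand k n p m j i                                   ≡⟨ summand-in-ℤ i ⟩
    s * (A * binom (j ℕ.* k ℕ.+ j) i * binom (n ∸ m) p)   ≡⟨ cong (λ x → s * (A * x * binom (n ∸ m) p)) (binom-vanish bound<i′) ⟩
    s * (A * + 0 * binom (n ∸ m) p)                       ≡⟨ annihilate s A (binom (n ∸ m) p) ⟩
    + 0                                                   ∎
    where
    A = + (2 ℕ.^ e i) * binom m j * + binomℤ (m ∸ j) (+ n - + i)
    bound<i′ : j ℕ.* k ℕ.+ j < i
    bound<i′ = subst (λ b → b ℕ.+ j < i) (ℕₚ.*-comm k j) bound<i
    annihilate : ∀ s a f → s * (a * + 0 * f) ≡ + 0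
    annihilate = solve-∀

  sumTo-summand : sumTo (k ℕ.* j ℕ.+ j) (summand k n p m j)
                  ≡ binom m j * ((+ 2) ^ j * (sign (m ∸ j) * (binom (j ℕ.* k ℕ.+ j) ⊛ T) n)) * binom⁻¹ (n ∸ m) p
  sumTo-summand = begin
    sumTo (k ℕ.* j ℕ.+ j) (summand k n p m j)
      ≡⟨ sumTo≡Σ< (k ℕ.* j ℕ.+ j) (summand k n p m j) ⟩
    Σ< (suc (k ℕ.* j ℕ.+ j)) (summand k n p m j)
      ≡⟨ Σ-cutoff (suc (k ℕ.* j ℕ.+ j)) (suc n) (summand k n p m j) summand-vanish-k summand-vanish-n ⟩
    Σ< (suc n) (summand k n p m j)
      ≡⟨ Σ-cong (suc n) (λ i i≤n → summand-factorises i (ℕₚ.≤-pred i≤n)) ⟩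
    Σ< (suc n) (λ i → summand-factor * (binom (j ℕ.* k ℕ.+ j) i * T (n ∸ i)))
      ≡⟨ *-distribˡ-Σ (suc n) summand-factor (λ i → binom (j ℕ.* k ℕ.+ j) i * T (n ∸ i)) ⟨
    summand-factor * (binom (j ℕ.* k ℕ.+ j) ⊛ T) n
      ≡⟨ rearrange (binom m j) ((+ 2) ^ j) (sign (m ∸ j)) (binom⁻¹ (n ∸ m) p) ((binom (j ℕ.* k ℕ.+ j) ⊛ T) n) ⟩
    binom m j * ((+ 2) ^ j * (sign (m ∸ j) * (binom (j ℕ.* k ℕ.+ j) ⊛ T) n)) * binom⁻¹ (n ∸ m) p ∎
    where
    rearrange : ∀ b q s v x → b * q * s * v * x ≡ b * (q * (s * x)) * v
    rearrange = solve-∀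

formula≡Σ-chainPowers : ∀ k n p →
  formula k n p ≡ Σ< (suc n) (λ m → (oddChainSeries k ⊛^ m) (n ∸ m) * binom⁻¹ (n ∸ m) p)
formula≡Σ-chainPowers k n p = begin
  formula k n p
    ≡⟨ sumTo≡Σ< n (λ m → sumTo m (λ j → sumTo (k ℕ.* j ℕ.+ j) (summand k n p m j))) ⟩
  Σ< (suc n) (λ m → sumTo m (λ j → sumTo (k ℕ.* j ℕ.+ j) (summand k n p m j)))
    ≡⟨ Σ-cong (suc n) (λ m m≤n → inner m (ℕₚ.≤-pred m≤n)) ⟩
  Σ< (suc n) (λ m → (oddChainSeries k ⊛^ m) (n ∸ m) * binom⁻¹ (n ∸ m) p) ∎
  where
  term : ℕ → ℕ → ℤ
  term m j = binom m j * ((+ 2) ^ j * (sign (m ∸ j) * (binom (j ℕ.* k ℕ.+ j) ⊛ twoPlusX ⊛^ (m ∸ j)) n))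
  inner : ∀ m → m ≤ n → sumTo m (λ j → sumTo (k ℕ.* j ℕ.+ j) (summand k n p m j)) ≡ (oddChainSeries k ⊛^ m) (n ∸ m) * binom⁻¹ (n ∸ m) p
  inner m m≤n = begin
    sumTo m (λ j → sumTo (k ℕ.* j ℕ.+ j) (summand k n p m j))
      ≡⟨ sumTo≡Σ< m (λ j → sumTo (k ℕ.* j ℕ.+ j) (summand k n p m j)) ⟩
    Σ< (suc m) (λ j → sumTo (k ℕ.* j ℕ.+ j) (summand k n p m j))
      ≡⟨ Σ-cong (suc m) (λ j j≤m → sumTo-summand k n p m j (ℕₚ.≤-pred j≤m) m≤n) ⟩
    Σ< (suc m) (λ j → term m j * binom⁻¹ (n ∸ m) p)
      ≡⟨ *-distribʳ-Σ (suc m) (binom⁻¹ (n ∸ m) p) (term m) ⟨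
    Σ< (suc m) (term m) * binom⁻¹ (n ∸ m) p
      ≡⟨ cong (_* binom⁻¹ (n ∸ m) p) (oddChainSeries-⊛^ k m n m≤n) ⟨
    (oddChainSeries k ⊛^ m) (n ∸ m) * binom⁻¹ (n ∸ m) p ∎

corollary5p7 : (k n p : ℕ) →
    (+ countWords (2 ℕ.* k ℕ.+ 1) n desO p ≡ formula k n p)
      × (+ countWords (2 ℕ.* k ℕ.+ 1) n risO p ≡ formula k n p)
corollary5p7 k n p = trans (Des.countWords≡Σ-chainPowers n p) (via des-chainSeries)
                   , trans (Ris.countWords≡Σ-chainPowers n p) (via ris-chainSeries)
  where
  open OddLetterChains k
  via : ∀ {S} → S ≗ oddChainSeries k →
        Σ< (suc n) (λ m → (S ⊛^ m) (n ∸ m) * binom⁻¹ (n ∸ m) p) ≡ formula k n p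
  via S≗ = trans (Σ-cong-≗ (suc n) (λ m → cong (_* binom⁻¹ (n ∸ m) p) (⊛^-cong m S≗ (n ∸ m))))
                 (sym (formula≡Σ-chainPowers k n p))
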